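{- Let $G$ be a finite graph with vertex set $V$ and weight function $\omega:V\to\mathbb{Z}_{>0}$, and let $a_V(1),a_V(2),\dots$ be the unique real numbers with $\prod_{k\ge1}(1+t^k)^{a_V(k)} = I_{(G,\omega)}(t)$ as formal power series. Define $$Y_{(G,\omega)} := \sum_\kappa\prod_{v\in V}\Big(\prod_{i\in\kappa(v)}x_i\Big)^{\omega(v)},$$ where the sum ranges over all maps $\kappa$ assigning to each vertex a (possibly empty) subset of $\mathbb{Z}_{>0}$ such that $\kappa(v)\cap\kappa(w)=\varnothing$ whenever $vw$ is an edge. Then $$Y_{(G,\omega)} = \prod_{k\ge1}(1+\overline{p}_k)^{a_V(k)}.$$
   Context: For $S\subseteq V$, $\omega(S)=\sum_{v\in S}\omega(v)$. The independence polynomial is $I_{(G,\omega)}(t)=\sum_S t^{\omega(S)}$ over all independent sets $S$ of $G$ (including $\varnothing$). For real $a$, $(1+u)^a=\sum_{i\ge0}\binom{a}{i}u^i$. $\overline{p}_k$ is the Kromatic symmetric function of a single vertex of weight $k$, i.e. $\overline{p}_k=\sum_{A}\prod_{i\in A}x_i^k$ over all nonempty finite subsets $A\subseteq\mathbb{Z}_{>0}$ (so that $1+\overline{p}_k=\prod_{i\ge1}(1+x_i^k)$).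
   Formalization: The exponents $a_V(k)$ and the coefficients of all the power series are rational rather than real. -}

module Defs where

open import Data.Nat as ℕ using (ℕ; zero; suc)
open import Data.Bool using (Bool; true; false; if_then_else_; _∧_; _∨_; not)
open import Data.Fin using (Fin)
open import Data.Vec as Vec using (Vec; []; _∷_)
open import Data.List as List using (List; []; _∷_; _++_; upTo; concatMap; filter)
open import Data.Integer using (+_)
open import Data.Rational as ℚ using (ℚ; 0ℚ; 1ℚ)
open import Relation.Nullary.Decidable using (does)
import Data.Bool.ListAction as BL
import Data.Nat.ListAction as NL

allSubsets : (n : ℕ) → List (Vec Bool n)
allSubsets zero    = [] ∷ []
allSubsets (suc n) = concatMap (λ s → (false ∷ s) ∷ (true ∷ s) ∷ []) (allSubsets n)

allVecs : {A : Set} → List A → (m : ℕ) → List (Vec A m)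
allVecs xs zero    = [] ∷ []
allVecs xs (suc m) = concatMap (λ x → List.map (x ∷_) (allVecs xs m)) xs

below : {n : ℕ} → Vec ℕ n → List (Vec ℕ n)
below []      = [] ∷ []
below (a ∷ α) = concatMap (λ b → List.map (b ∷_) (below α)) (upTo (suc a))

vecEq : {n : ℕ} → Vec ℕ n → Vec ℕ n → Bool
vecEq []      []      = true
vecEq (a ∷ α) (b ∷ β) = does (a ℕ.≟ b) ∧ vecEq α β

ℚsum : List ℚ → ℚ
ℚsum = List.foldr ℚ._+_ 0ℚ

fromℕ : ℕ → ℚ
fromℕ k = + k ℚ./ 1

-- Formal power series over ℚ in n commuting variables x₁ … xₙ,
-- given by their coefficient function on exponent vectors.

FPS : ℕ → Set
FPS n = Vec ℕ n → ℚ

deg : {n : ℕ} → Vec ℕ n → ℕ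
deg = Vec.sum

mono : {n : ℕ} → Vec ℕ n → FPS n
mono β α = if vecEq α β then 1ℚ else 0ℚ

oneS : {n : ℕ} → FPS n
oneS = mono (Vec.replicate _ 0)

_⊕_ : {n : ℕ} → FPS n → FPS n → FPS n
(f ⊕ g) α = f α ℚ.+ g α

sumS : {n : ℕ} → List (FPS n) → FPS n
sumS fs α = ℚsum (List.map (λ f → f α) fs)

_⊗_ : {n : ℕ} → FPS n → FPS n → FPS n
(f ⊗ g) α = ℚsum (List.map (λ β → f β ℚ.* g (Vec.zipWith ℕ._∸_ α β)) (below α))

_^S_ : {n : ℕ} → FPS n → ℕ → FPS n
f ^S zero  = oneS
f ^S suc i = f ⊗ (f ^S i)

binom : ℚ → ℕ → ℚ
binom a zero    = 1ℚ
binom a (suc i) = binom a i ℚ.* ((a ℚ.- fromℕ i) ℚ.* (+ 1 ℚ./ suc i))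

-- (1+u)^a = Σ_i binom a i u^i, for u with zero constant term
-- (only the terms i ≤ deg α can contribute to the coefficient of x^α).
binomPow : {n : ℕ} → ℚ → FPS n → FPS n
binomPow a u α = ℚsum (List.map (λ i → binom a i ℚ.* (u ^S i) α) (upTo (suc (deg α))))

prodTo : {n : ℕ} → (ℕ → FPS n) → ℕ → FPS n
prodTo F zero    = oneS
prodTo F (suc K) = prodTo F K ⊗ F (suc K)

-- infinite product ∏_{k ≥ 1} F k, for F k ≡ 1 modulo terms of degree ≥ k
-- (only the factors k ≤ deg α can contribute to the coefficient of x^α).
infProd : {n : ℕ} → (ℕ → FPS n) → FPS n
infProd F α = prodTo F (deg α) α

independent : {m : ℕ} → (Fin m → Fin m → Bool) → Vec Bool m → Bool
independent {m} adj S =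
  BL.all (λ u → BL.all (λ v → not (Vec.lookup S u ∧ Vec.lookup S v ∧ adj u v))
                             (List.allFin m)) (List.allFin m)

weightOf : {m : ℕ} → (Fin m → ℕ) → Vec Bool m → ℕ
weightOf {m} ω S = NL.sum (List.map (λ v → if Vec.lookup S v then ω v else 0) (List.allFin m))

indepPoly : {m : ℕ} → (Fin m → Fin m → Bool) → (Fin m → ℕ) → FPS 1
indepPoly {m} adj ω =
  sumS (List.map (λ S → mono (weightOf ω S ∷ [])) (filter (λ S → independent adj S ≟b true) (allSubsets m)))
  where
    open import Data.Bool.Properties using () renaming (_≟_ to _≟b_)

tPow : ℕ → FPS 1
tPow k = mono (k ∷ [])

-- p̄_k restricted to the variables x₁ … xₙ :  Σ_{∅ ≠ A ⊆ {1..n}} ∏_{i∈A} x_i^k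
pbar : (n k : ℕ) → FPS n
pbar n k = sumS (List.map (λ A → mono (Vec.map (λ b → if b then k else 0) A))
                         (filter (λ A → Vec.foldr _ _∨_ false A ≟b true) (allSubsets n)))
  where
    open import Data.Bool.Properties using () renaming (_≟_ to _≟b_)

properMap : {m n : ℕ} → (Fin m → Fin m → Bool) → Vec (Vec Bool n) m → Bool
properMap {m} {n} adj κ =
  BL.all (λ u → BL.all (λ v → not (adj u v) ∨
      BL.all (λ i → not (Vec.lookup (Vec.lookup κ u) i ∧ Vec.lookup (Vec.lookup κ v) i))
               (List.allFin n)) (List.allFin m)) (List.allFin m)

kappaExp : {m n : ℕ} → (Fin m → ℕ) → Vec (Vec Bool n) m → Vec ℕ n
kappaExp {m} {n} ω κ =
  Vec.tabulate (λ i → NL.sum (List.map (λ v → if Vec.lookup (Vec.lookup κ v) i then ω v else 0)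
                                         (List.allFin m)))

-- Y_{(G,ω)} with variables x_{n+1}, x_{n+2}, … set to 0
-- (i.e. κ ranges over maps into subsets of {1..n})
Yser : {m : ℕ} → (Fin m → Fin m → Bool) → (Fin m → ℕ) → (n : ℕ) → FPS n
Yser {m} adj ω n =
  sumS (List.map (λ κ → mono (kappaExp ω κ))
                 (filter (λ κ → properMap adj κ ≟b true) (allVecs (allSubsets n) m)))
  where
    open import Data.Bool.Properties using () renaming (_≟_ to _≟b_)

{-# OPTIONS --safe #-}

-- Both sides factor over the variables. A map κ amounts to a choice, for each variable xᵢ,
-- of the vertex set {v : i ∈ κ(v)}, and κ is proper exactly when all these sets are
-- independent; so the coefficient of x₁^d x^β in Y is the coefficient of t^d in I(t) times
-- the coefficient of x^β in Y over the remaining variables. On the other side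
-- 1 + p̄ₖ(x₁, x₂, …) = (1 + x₁ᵏ)(1 + p̄ₖ(x₂, …)), and (1 + u)^a (1 + v)^a = ((1 + u)(1 + v))^a
-- for series u, v in disjoint variables without constant term: both sides have constant
-- term 1 and solve (1 + w) E h = a (E w) h, where E = Σᵢ xᵢ∂ᵢ is the Euler operator, and
-- this equation determines h from its constant term because E multiplies the coefficient
-- of x^α by deg α. Induction on the number of variables, with the hypothesis as the
-- one-variable case, finishes the proof.

module Submission where

open import Defs
open import Data.Nat using (ℕ; _≤_)
open import Data.Bool using (Bool; false)
open import Data.Fin using (Fin)
open import Data.Vec using (Vec)
open import Data.Rational using (ℚ)
open import Relation.Binary.PropositionalEquality using (_≡_)

open import Algebra.Bundles using (Ring; CommutativeMonoid)
open import Data.Bool using (true; _∧_; _∨_; not; if_then_else_; T)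
import Data.Bool.ListAction as BoolL
import Data.Bool.Properties as BoolP
open import Data.Fin as Fin using (toℕ)
import Data.Fin.Properties as FinP
import Data.Integer as ℤ
import Data.Integer.Properties as ℤP
import Data.Integer.Tactic.RingSolver as ℤSolver
open import Data.List as List using (List; upTo; concatMap; filter; allFin)
import Data.List.Properties as ListP
open import Data.Nat as ℕ using (zero; suc; _∸_; _<_; z≤n; s≤s)
import Data.Nat.Coprimality as Coprime
import Data.Nat.ListAction as ℕL
import Data.Nat.Properties as ℕP
import Data.Nat.Tactic.RingSolver as ℕSolver
open import Data.Product using (_,_)
open import Data.Rational as ℚ using (0ℚ; 1ℚ; _+_; _*_; _-_; _/_; toℚᵘ)
import Data.Rational.Properties as ℚP
import Data.Rational.Unnormalised as ℚᵘ
import Data.Rational.Unnormalised.Properties as ℚᵘP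
open import Data.Sum using (_⊎_; inj₁; inj₂; [_,_])
open import Data.Vec as Vec using ([]; _∷_; zipWith)
import Data.Vec.Properties as VecP
open import Data.Vec.Relation.Binary.Pointwise.Inductive using (Pointwise; []; _∷_)
open import Function using (_∘_; id; Equivalence)
open import Relation.Binary.PropositionalEquality
  using (refl; sym; trans; cong; cong₂; subst; _≗_; module ≡-Reasoning)
open import Relation.Nullary using (Dec; does; yes; no)
open import Relation.Nullary.Decidable using (dec⇒maybe; dec-true; dec-false)
open import Tactic.RingSolver using (solve-∀)
open import Tactic.RingSolver.Core.AlmostCommutativeRing
  using (AlmostCommutativeRing; fromCommutativeRing)

open import Algebra.Properties.CommutativeMonoid.Sum ℚP.+-0-commutativeMonoid
  using (sum; sum-cong-≗; sum-replicate-zero; sum-init-last; ∑-distrib-+; ∑-comm)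
open import Algebra.Properties.Semiring.Sum (Ring.semiring ℚP.+-*-ring)
  using (*-distribˡ-sum; *-distribʳ-sum)
open import Algebra.Properties.CommutativeSemigroup
  (CommutativeMonoid.commutativeSemigroup ℚP.+-0-commutativeMonoid)
  using () renaming (interchange to +-interchange)
open import Algebra.Properties.CommutativeSemigroup
  (CommutativeMonoid.commutativeSemigroup BoolP.∧-commutativeMonoid)
  using () renaming (interchange to ∧-interchange)

ℚ-ring : AlmostCommutativeRing _ _
ℚ-ring = fromCommutativeRing ℚP.+-*-commutativeRing (λ x → dec⇒maybe (0ℚ ℚP.≟ x))

-- ℤ's +_ is opened only here: elsewhere it would clash with the sections (x +_) of ℚ's _+_.
module _ where

  open import Data.Integer using (+_)

  toℚᵘ-fromℕ : ∀ k → toℚᵘ (fromℕ k) ≡ ℚᵘ.mkℚᵘ (+ k) 0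
  toℚᵘ-fromℕ k = cong toℚᵘ (ℚP.normalize-coprime (Coprime.sym (Coprime.1-coprimeTo k)))

  fromℕ-+ : ∀ m n → fromℕ (m ℕ.+ n) ≡ fromℕ m + fromℕ n
  fromℕ-+ m n = ℚP.toℚᵘ-injective (begin
      toℚᵘ (fromℕ (m ℕ.+ n))                   ≡⟨ toℚᵘ-fromℕ (m ℕ.+ n) ⟩
      ℚᵘ.mkℚᵘ (+ (m ℕ.+ n)) 0                    ≈⟨ ℚᵘ.*≡* numerators ⟩
      ℚᵘ.mkℚᵘ (+ m) 0 ℚᵘ.+ ℚᵘ.mkℚᵘ (+ n) 0      ≡⟨ sym (cong₂ ℚᵘ._+_ (toℚᵘ-fromℕ m) (toℚᵘ-fromℕ n)) ⟩
      toℚᵘ (fromℕ m) ℚᵘ.+ toℚᵘ (fromℕ n)        ≈⟨ ℚᵘP.≃-sym (ℚP.toℚᵘ-homo-+ (fromℕ m) (fromℕ n)) ⟩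
      toℚᵘ (fromℕ m + fromℕ n)                  ∎)
    where
    open ℚᵘP.≃-Reasoning
    unitDenominators : ∀ x y → (x ℤ.+ y) ℤ.* + 1 ≡ (x ℤ.* + 1 ℤ.+ y ℤ.* + 1) ℤ.* + 1
    unitDenominators = ℤSolver.solve-∀
    numerators : + (m ℕ.+ n) ℤ.* + 1 ≡ (+ m ℤ.* + 1 ℤ.+ + n ℤ.* + 1) ℤ.* + 1
    numerators = trans (cong (ℤ._* + 1) (ℤP.pos-+ m n)) (unitDenominators (+ m) (+ n))

  *-inverseˡ-fromℕ-suc : ∀ n → (+ 1 / suc n) * fromℕ (suc n) ≡ 1ℚ
  *-inverseˡ-fromℕ-suc n
    rewrite ℚP.normalize-coprime (Coprime.sym (Coprime.1-coprimeTo (suc n)))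
          | ℚP.normalize-coprime {1} {n} (Coprime.1-coprimeTo (suc n))
    = ℚP.*-inverseˡ (ℚ.mkℚ (+ suc n) 0 (Coprime.sym (Coprime.1-coprimeTo (suc n))))

  *-cancelˡ-fromℕ-suc : ∀ n {x y} → fromℕ (suc n) * x ≡ fromℕ (suc n) * y → x ≡ y
  *-cancelˡ-fromℕ-suc n {x} {y} eq =
    trans (sym (undo x)) (trans (cong ((+ 1 / suc n) *_) eq) (undo y))
    where
    undo : ∀ z → (+ 1 / suc n) * (fromℕ (suc n) * z) ≡ z
    undo z = trans (sym (ℚP.*-assoc (+ 1 / suc n) (fromℕ (suc n)) z))
                   (trans (cong (_* z) (*-inverseˡ-fromℕ-suc n)) (ℚP.*-identityˡ z))

  binom-suc-* : ∀ a i → binom a (suc i) * fromℕ (suc i) ≡ binom a i * (a - fromℕ i)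
  binom-suc-* a i = begin
      binom a i * ((a - fromℕ i) * (+ 1 / suc i)) * fromℕ (suc i)
        ≡⟨ reassoc (binom a i) (a - fromℕ i) (+ 1 / suc i) (fromℕ (suc i)) ⟩
      binom a i * (a - fromℕ i) * ((+ 1 / suc i) * fromℕ (suc i))
        ≡⟨ cong (binom a i * (a - fromℕ i) *_) (*-inverseˡ-fromℕ-suc i) ⟩
      binom a i * (a - fromℕ i) * 1ℚ
        ≡⟨ ℚP.*-identityʳ _ ⟩
      binom a i * (a - fromℕ i) ∎
    where
    open ≡-Reasoning
    reassoc : ∀ x y z w → x * (y * z) * w ≡ x * y * (z * w)
    reassoc = solve-∀ ℚ-ring

fromℕ-suc : ∀ n → fromℕ (suc n) ≡ 1ℚ + fromℕ n
fromℕ-suc n = fromℕ-+ 1 n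

𝟙 : Bool → ℚ
𝟙 b = if b then 1ℚ else 0ℚ

𝟙-∧ : ∀ x y → 𝟙 (x ∧ y) ≡ 𝟙 x * 𝟙 y
𝟙-∧ true  y = sym (ℚP.*-identityˡ (𝟙 y))
𝟙-∧ false y = sym (ℚP.*-zeroˡ (𝟙 y))

private variable
  A B : Set

ℚsum-cong : ∀ {f g : A → ℚ} xs → f ≗ g → ℚsum (List.map f xs) ≡ ℚsum (List.map g xs)
ℚsum-cong xs f≗g = cong ℚsum (ListP.map-cong f≗g xs)

ℚsum-++ : ∀ (f : A → ℚ) xs ys →
  ℚsum (List.map f (xs List.++ ys)) ≡ ℚsum (List.map f xs) + ℚsum (List.map f ys)
ℚsum-++ f List.[]       ys = sym (ℚP.+-identityˡ _)
ℚsum-++ f (x List.∷ xs) ys =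
  trans (cong (f x +_) (ℚsum-++ f xs ys)) (sym (ℚP.+-assoc (f x) _ _))

ℚsum-concatMap : ∀ (f : B → ℚ) (g : A → List B) xs →
  ℚsum (List.map f (concatMap g xs)) ≡ ℚsum (List.map (λ x → ℚsum (List.map f (g x))) xs)
ℚsum-concatMap f g List.[]       = refl
ℚsum-concatMap f g (x List.∷ xs) =
  trans (ℚsum-++ f (g x) (concatMap g xs))
        (cong (ℚsum (List.map f (g x)) +_) (ℚsum-concatMap f g xs))

ℚsum-+ : ∀ (f g : A → ℚ) xs →
  ℚsum (List.map (λ x → f x + g x) xs) ≡ ℚsum (List.map f xs) + ℚsum (List.map g xs)
ℚsum-+ f g List.[]       = refl
ℚsum-+ f g (x List.∷ xs) =
  trans (cong (f x + g x +_) (ℚsum-+ f g xs)) (+-interchange (f x) (g x) _ _)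

ℚsum-*ˡ : ∀ c (f : A → ℚ) xs → ℚsum (List.map (λ x → c * f x) xs) ≡ c * ℚsum (List.map f xs)
ℚsum-*ˡ c f List.[]       = sym (ℚP.*-zeroʳ c)
ℚsum-*ˡ c f (x List.∷ xs) =
  trans (cong (c * f x +_) (ℚsum-*ˡ c f xs)) (sym (ℚP.*-distribˡ-+ c _ _))

ℚsum-*ʳ : ∀ c (f : A → ℚ) xs → ℚsum (List.map (λ x → f x * c) xs) ≡ ℚsum (List.map f xs) * c
ℚsum-*ʳ c f xs = trans (ℚsum-cong xs (λ x → ℚP.*-comm (f x) c))
                       (trans (ℚsum-*ˡ c f xs) (ℚP.*-comm c _))

ℚsum-zero : ∀ (xs : List A) → ℚsum (List.map (λ _ → 0ℚ) xs) ≡ 0ℚ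
ℚsum-zero List.[]       = refl
ℚsum-zero (x List.∷ xs) = trans (cong (0ℚ +_) (ℚsum-zero xs)) (ℚP.+-identityˡ 0ℚ)

ℚsum-comm : ∀ (F : A → B → ℚ) xs ys →
  ℚsum (List.map (λ x → ℚsum (List.map (F x) ys)) xs) ≡
  ℚsum (List.map (λ y → ℚsum (List.map (λ x → F x y) xs)) ys)
ℚsum-comm F List.[]       ys = sym (ℚsum-zero ys)
ℚsum-comm F (x List.∷ xs) ys =
  trans (cong (ℚsum (List.map (F x) ys) +_) (ℚsum-comm F xs ys))
        (sym (ℚsum-+ (F x) (λ y → ℚsum (List.map (λ x → F x y) xs)) ys))

ℚsum-filter : ∀ {P : A → Set} (P? : ∀ x → Dec (P x)) (f : A → ℚ) xs →
  ℚsum (List.map f (filter P? xs)) ≡ ℚsum (List.map (λ x → 𝟙 (does (P? x)) * f x) xs)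
ℚsum-filter P? f List.[]       = refl
ℚsum-filter P? f (x List.∷ xs) with does (P? x)
... | true  = cong₂ _+_ (sym (ℚP.*-identityˡ (f x))) (ℚsum-filter P? f xs)
... | false = trans (ℚsum-filter P? f xs)
                    (sym (trans (cong (_+ _) (ℚP.*-zeroˡ (f x))) (ℚP.+-identityˡ _)))

∑< : ℕ → (ℕ → ℚ) → ℚ
∑< n h = sum {n} (h ∘ toℕ)

∑<-cong : ∀ n {g h : ℕ → ℚ} → (∀ i → i < n → g i ≡ h i) → ∑< n g ≡ ∑< n h
∑<-cong n g≡h = sum-cong-≗ (λ i → g≡h (toℕ i) (FinP.toℕ<n i))

∑<-+ : ∀ n (g h : ℕ → ℚ) → ∑< n (λ i → g i + h i) ≡ ∑< n g + ∑< n h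
∑<-+ n g h = ∑-distrib-+ {n} (g ∘ toℕ) (h ∘ toℕ)

∑<-*ˡ : ∀ n c (h : ℕ → ℚ) → ∑< n (λ i → c * h i) ≡ c * ∑< n h
∑<-*ˡ n c h = sym (*-distribˡ-sum {n} c (h ∘ toℕ))

∑<-*ʳ : ∀ n c (h : ℕ → ℚ) → ∑< n (λ i → h i * c) ≡ ∑< n h * c
∑<-*ʳ n c h = sym (*-distribʳ-sum {n} c (h ∘ toℕ))

∑<-zero : ∀ n {h : ℕ → ℚ} → (∀ i → i < n → h i ≡ 0ℚ) → ∑< n h ≡ 0ℚ
∑<-zero n h≡0 = trans (∑<-cong n h≡0) (sum-replicate-zero n)

∑<-comm : ∀ m n (F : ℕ → ℕ → ℚ) → ∑< m (λ i → ∑< n (F i)) ≡ ∑< n (λ j → ∑< m (λ i → F i j))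
∑<-comm m n F = ∑-comm {m} {n} (λ i j → F (toℕ i) (toℕ j))

∑<-last : ∀ n (h : ℕ → ℚ) → ∑< (suc n) h ≡ ∑< n h + h n
∑<-last n h = trans (sum-init-last {n} (h ∘ toℕ))
  (cong₂ _+_ (sum-cong-≗ {n} {h ∘ toℕ ∘ Fin.inject₁} {h ∘ toℕ} (cong h ∘ FinP.toℕ-inject₁))
             (cong h (FinP.toℕ-fromℕ n)))

∑<-extend : ∀ K M (h : ℕ → ℚ) → (∀ i → M ≤ i → h i ≡ 0ℚ) → ∑< (K ℕ.+ M) h ≡ ∑< M h
∑<-extend zero    M h h≡0 = refl
∑<-extend (suc K) M h h≡0 = begin
    ∑< (suc (K ℕ.+ M)) h         ≡⟨ ∑<-last (K ℕ.+ M) h ⟩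
    ∑< (K ℕ.+ M) h + h (K ℕ.+ M) ≡⟨ cong₂ _+_ (∑<-extend K M h h≡0) (h≡0 (K ℕ.+ M) (ℕP.m≤n+m M K)) ⟩
    ∑< M h + 0ℚ                  ≡⟨ ℚP.+-identityʳ _ ⟩
    ∑< M h                       ∎
  where open ≡-Reasoning

ℚsum-applyUpTo : ∀ (h : ℕ → ℚ) f n → ℚsum (List.map h (List.applyUpTo f n)) ≡ ∑< n (h ∘ f)
ℚsum-applyUpTo h f zero    = refl
ℚsum-applyUpTo h f (suc n) = cong (h (f 0) +_) (ℚsum-applyUpTo h (f ∘ suc) n)

∑<-reverse : ∀ a (h : ℕ → ℚ) → ∑< (suc a) h ≡ ∑< (suc a) (λ b → h (a ∸ b))
∑<-reverse zero    h = refl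
∑<-reverse (suc a) h = begin
    h 0 + ∑< (suc a) (h ∘ suc)
  ≡⟨ cong (h 0 +_) (∑<-reverse a (h ∘ suc)) ⟩
    h 0 + ∑< (suc a) (λ b → h (suc (a ∸ b)))
  ≡⟨ cong (h 0 +_) (∑<-cong (suc a) (λ b b≤a → cong h (sym (ℕP.+-∸-assoc 1 (ℕP.≤-pred b≤a))))) ⟩
    h 0 + ∑< (suc a) (λ b → h (suc a ∸ b))
  ≡⟨ ℚP.+-comm (h 0) _ ⟩
    ∑< (suc a) (λ b → h (suc a ∸ b)) + h 0
  ≡⟨ cong (λ z → ∑< (suc a) (λ b → h (suc a ∸ b)) + h z) (sym (ℕP.n∸n≡0 a)) ⟩
    ∑< (suc a) (λ b → h (suc a ∸ b)) + h (suc a ∸ suc a)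
  ≡⟨ sym (∑<-last (suc a) (λ b → h (suc a ∸ b))) ⟩
    ∑< (suc (suc a)) (λ b → h (suc a ∸ b)) ∎
  where open ≡-Reasoning

∑<-triangle : ∀ a (G : ℕ → ℕ → ℚ) →
  ∑< (suc a) (λ c → ∑< (suc (a ∸ c)) (G c)) ≡ ∑< (suc a) (λ b → ∑< (suc b) (λ c → G c (b ∸ c)))
∑<-triangle zero    G = refl
∑<-triangle (suc a) G = begin
    ∑< (suc (suc a)) (G 0) + ∑< (suc a) (λ c → ∑< (suc (a ∸ c)) (G (suc c)))
  ≡⟨ cong (∑< (suc (suc a)) (G 0) +_) (∑<-triangle a (G ∘ suc)) ⟩
    (G 0 0 + ∑< (suc a) (G 0 ∘ suc)) + ∑< (suc a) (λ b → ∑< (suc b) (λ c → G (suc c) (b ∸ c)))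
  ≡⟨ ℚP.+-assoc (G 0 0) _ _ ⟩
    G 0 0 + (∑< (suc a) (G 0 ∘ suc) + ∑< (suc a) (λ b → ∑< (suc b) (λ c → G (suc c) (b ∸ c))))
  ≡⟨ cong₂ _+_ (sym (ℚP.+-identityʳ (G 0 0)))
               (sym (∑<-+ (suc a) (G 0 ∘ suc) (λ b → ∑< (suc b) (λ c → G (suc c) (b ∸ c))))) ⟩
    (G 0 0 + 0ℚ) + ∑< (suc a) (λ b → G 0 (suc b) + ∑< (suc b) (λ c → G (suc c) (b ∸ c))) ∎
  where open ≡-Reasoning

infixl 6 _∸ᵥ_
_∸ᵥ_ : ∀ {n} → Vec ℕ n → Vec ℕ n → Vec ℕ n
_∸ᵥ_ = zipWith _∸_

infix 4 _≤ᵥ_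
_≤ᵥ_ : ∀ {n} → Vec ℕ n → Vec ℕ n → Set
_≤ᵥ_ = Pointwise _≤_

0ᵥ : ∀ n → Vec ℕ n
0ᵥ n = Vec.replicate n 0

∸ᵥ-≤ᵥ : ∀ {n} (α β : Vec ℕ n) → α ∸ᵥ β ≤ᵥ α
∸ᵥ-≤ᵥ []      []      = []
∸ᵥ-≤ᵥ (a ∷ α) (b ∷ β) = ℕP.m∸n≤m a b ∷ ∸ᵥ-≤ᵥ α β

∸ᵥ-identityʳ : ∀ {n} (α : Vec ℕ n) → α ∸ᵥ 0ᵥ n ≡ α
∸ᵥ-identityʳ []      = refl
∸ᵥ-identityʳ (a ∷ α) = cong (a ∷_) (∸ᵥ-identityʳ α)

α∸ᵥ[α∸ᵥβ]≡β : ∀ {n} {α β : Vec ℕ n} → β ≤ᵥ α → α ∸ᵥ (α ∸ᵥ β) ≡ β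
α∸ᵥ[α∸ᵥβ]≡β []       = refl
α∸ᵥ[α∸ᵥβ]≡β (b≤a ∷ β≤α) = cong₂ _∷_ (ℕP.m∸[m∸n]≡n b≤a) (α∸ᵥ[α∸ᵥβ]≡β β≤α)

[α∸ᵥγ]∸ᵥ[β∸ᵥγ]≡α∸ᵥβ : ∀ {n} {α β γ : Vec ℕ n} → γ ≤ᵥ β →
  (α ∸ᵥ γ) ∸ᵥ (β ∸ᵥ γ) ≡ α ∸ᵥ β
[α∸ᵥγ]∸ᵥ[β∸ᵥγ]≡α∸ᵥβ {α = []}    {[]}    {[]}    []          = refl
[α∸ᵥγ]∸ᵥ[β∸ᵥγ]≡α∸ᵥβ {α = a ∷ α} {b ∷ β} {c ∷ γ} (c≤b ∷ γ≤β) =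
  cong₂ _∷_ (trans (ℕP.∸-+-assoc a c (b ∸ c)) (cong (a ∸_) (ℕP.m+[n∸m]≡n c≤b)))
            ([α∸ᵥγ]∸ᵥ[β∸ᵥγ]≡α∸ᵥβ γ≤β)

deg-∸ᵥ : ∀ {n} {α β : Vec ℕ n} → β ≤ᵥ α → deg β ℕ.+ deg (α ∸ᵥ β) ≡ deg α
deg-∸ᵥ {α = []}    {[]}    []          = refl
deg-∸ᵥ {α = a ∷ α} {b ∷ β} (b≤a ∷ β≤α) = begin
    b ℕ.+ deg β ℕ.+ (a ∸ b ℕ.+ deg (α ∸ᵥ β))   ≡⟨ interchange b (deg β) (a ∸ b) (deg (α ∸ᵥ β)) ⟩
    (b ℕ.+ (a ∸ b)) ℕ.+ (deg β ℕ.+ deg (α ∸ᵥ β)) ≡⟨ cong₂ ℕ._+_ (ℕP.m+[n∸m]≡n b≤a) (deg-∸ᵥ β≤α) ⟩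
    a ℕ.+ deg α                                   ∎
  where
  open ≡-Reasoning
  interchange : ∀ x y z w → x ℕ.+ y ℕ.+ (z ℕ.+ w) ≡ (x ℕ.+ z) ℕ.+ (y ℕ.+ w)
  interchange = ℕSolver.solve-∀

deg-mono-≤ᵥ : ∀ {n} {α β : Vec ℕ n} → β ≤ᵥ α → deg β ≤ deg α
deg-mono-≤ᵥ {α = α} {β} β≤α = subst (deg β ≤_) (deg-∸ᵥ β≤α) (ℕP.m≤m+n (deg β) (deg (α ∸ᵥ β)))

deg-0ᵥ : ∀ n → deg (0ᵥ n) ≡ 0
deg-0ᵥ zero    = refl
deg-0ᵥ (suc n) = deg-0ᵥ n

deg≡0⇒≡0ᵥ : ∀ {n} (α : Vec ℕ n) → deg α ≡ 0 → α ≡ 0ᵥ n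
deg≡0⇒≡0ᵥ []         _   = refl
deg≡0⇒≡0ᵥ (zero ∷ α) eq = cong (0 ∷_) (deg≡0⇒≡0ᵥ α eq)

vecEq-refl : ∀ {n} (α : Vec ℕ n) → vecEq α α ≡ true
vecEq-refl []      = refl
vecEq-refl (a ∷ α) = cong₂ _∧_ (dec-true (a ℕ.≟ a) refl) (vecEq-refl α)

vecEq-sound : ∀ {n} (α β : Vec ℕ n) → T (vecEq α β) → α ≡ β
vecEq-sound []      []      _ = refl
vecEq-sound (a ∷ α) (b ∷ β) h with Equivalence.to (BoolP.T-∧ {does (a ℕ.≟ b)}) h
... | a≡ᵇb , α≈β = cong₂ _∷_ (ℕP.≡ᵇ⇒≡ a b a≡ᵇb) (vecEq-sound α β α≈β)

∑≤ : ∀ {n} → Vec ℕ n → (Vec ℕ n → ℚ) → ℚ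
∑≤ []      φ = φ []
∑≤ (a ∷ α) φ = ∑< (suc a) (λ b → ∑≤ α (φ ∘ (b ∷_)))

ℚsum-below : ∀ {n} (α : Vec ℕ n) (φ : Vec ℕ n → ℚ) → ℚsum (List.map φ (below α)) ≡ ∑≤ α φ
ℚsum-below []      φ = ℚP.+-identityʳ (φ [])
ℚsum-below (a ∷ α) φ = begin
    ℚsum (List.map φ (concatMap (λ b → List.map (b ∷_) (below α)) (upTo (suc a))))
  ≡⟨ ℚsum-concatMap φ (λ b → List.map (b ∷_) (below α)) (upTo (suc a)) ⟩
    ℚsum (List.map (λ b → ℚsum (List.map φ (List.map (b ∷_) (below α)))) (upTo (suc a)))
  ≡⟨ ℚsum-applyUpTo (λ b → ℚsum (List.map φ (List.map (b ∷_) (below α)))) id (suc a) ⟩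
    ∑< (suc a) (λ b → ℚsum (List.map φ (List.map (b ∷_) (below α))))
  ≡⟨ ∑<-cong (suc a) (λ b _ → trans (cong ℚsum (sym (ListP.map-∘ {g = φ} {f = b ∷_} (below α))))
                                    (ℚsum-below α (φ ∘ (b ∷_)))) ⟩
    ∑≤ (a ∷ α) φ ∎
  where open ≡-Reasoning

∑≤-cong : ∀ {n} (α : Vec ℕ n) {φ ψ : Vec ℕ n → ℚ} → (∀ β → β ≤ᵥ α → φ β ≡ ψ β) → ∑≤ α φ ≡ ∑≤ α ψ
∑≤-cong []      φ≡ψ = φ≡ψ [] []
∑≤-cong (a ∷ α) φ≡ψ =
  ∑<-cong (suc a) (λ b b<1+a → ∑≤-cong α (λ β β≤α → φ≡ψ (b ∷ β) (ℕP.≤-pred b<1+a ∷ β≤α)))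

∑≤-+ : ∀ {n} (α : Vec ℕ n) (φ ψ : Vec ℕ n → ℚ) → ∑≤ α (λ β → φ β + ψ β) ≡ ∑≤ α φ + ∑≤ α ψ
∑≤-+ []      φ ψ = refl
∑≤-+ (a ∷ α) φ ψ =
  trans (∑<-cong (suc a) (λ b _ → ∑≤-+ α (φ ∘ (b ∷_)) (ψ ∘ (b ∷_))))
        (∑<-+ (suc a) (λ b → ∑≤ α (φ ∘ (b ∷_))) (λ b → ∑≤ α (ψ ∘ (b ∷_))))

∑≤-*ˡ : ∀ {n} (α : Vec ℕ n) c (φ : Vec ℕ n → ℚ) → ∑≤ α (λ β → c * φ β) ≡ c * ∑≤ α φ
∑≤-*ˡ []      c φ = refl
∑≤-*ˡ (a ∷ α) c φ =
  trans (∑<-cong (suc a) (λ b _ → ∑≤-*ˡ α c (φ ∘ (b ∷_))))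
        (∑<-*ˡ (suc a) c (λ b → ∑≤ α (φ ∘ (b ∷_))))

∑≤-*ʳ : ∀ {n} (α : Vec ℕ n) c (φ : Vec ℕ n → ℚ) → ∑≤ α (λ β → φ β * c) ≡ ∑≤ α φ * c
∑≤-*ʳ α c φ = trans (∑≤-cong α (λ β _ → ℚP.*-comm (φ β) c))
                    (trans (∑≤-*ˡ α c φ) (ℚP.*-comm c (∑≤ α φ)))

∑≤-zero : ∀ {n} (α : Vec ℕ n) {φ : Vec ℕ n → ℚ} → (∀ β → β ≤ᵥ α → φ β ≡ 0ℚ) → ∑≤ α φ ≡ 0ℚ
∑≤-zero []      φ≡0 = φ≡0 [] []
∑≤-zero (a ∷ α) φ≡0 =
  ∑<-zero (suc a) (λ b b<1+a → ∑≤-zero α (λ β β≤α → φ≡0 (b ∷ β) (ℕP.≤-pred b<1+a ∷ β≤α)))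

∑<-∑≤-comm : ∀ {n} m (γ : Vec ℕ n) (G : ℕ → Vec ℕ n → ℚ) →
  ∑< m (λ i → ∑≤ γ (G i)) ≡ ∑≤ γ (λ δ → ∑< m (λ i → G i δ))
∑<-∑≤-comm m []      G = refl
∑<-∑≤-comm m (c ∷ γ) G =
  trans (∑<-comm m (suc c) (λ i d → ∑≤ γ (G i ∘ (d ∷_))))
        (∑<-cong (suc c) (λ d _ → ∑<-∑≤-comm m γ (λ i δ → G i (d ∷ δ))))

∑≤-reverse : ∀ {n} (α : Vec ℕ n) (φ : Vec ℕ n → ℚ) → ∑≤ α φ ≡ ∑≤ α (λ β → φ (α ∸ᵥ β))
∑≤-reverse []      φ = refl
∑≤-reverse (a ∷ α) φ =
  trans (∑<-cong (suc a) (λ b _ → ∑≤-reverse α (φ ∘ (b ∷_))))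
        (∑<-reverse a (λ b → ∑≤ α (λ β → φ (b ∷ (α ∸ᵥ β)))))

∑≤-triangle : ∀ {n} (α : Vec ℕ n) (F : Vec ℕ n → Vec ℕ n → ℚ) →
  ∑≤ α (λ γ → ∑≤ (α ∸ᵥ γ) (F γ)) ≡ ∑≤ α (λ β → ∑≤ β (λ γ → F γ (β ∸ᵥ γ)))
∑≤-triangle []      F = refl
∑≤-triangle (a ∷ α) F = begin
    ∑< (suc a) (λ c → ∑≤ α (λ γ → ∑< (suc (a ∸ c)) (λ d → ∑≤ (α ∸ᵥ γ) (F (c ∷ γ) ∘ (d ∷_)))))
  ≡⟨ ∑<-cong (suc a) (λ c _ → sym (∑<-∑≤-comm (suc (a ∸ c)) α
       (λ d γ → ∑≤ (α ∸ᵥ γ) (F (c ∷ γ) ∘ (d ∷_))))) ⟩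
    ∑< (suc a) (λ c → ∑< (suc (a ∸ c)) (λ d → ∑≤ α (λ γ → ∑≤ (α ∸ᵥ γ) (F (c ∷ γ) ∘ (d ∷_)))))
  ≡⟨ ∑<-triangle a (λ c d → ∑≤ α (λ γ → ∑≤ (α ∸ᵥ γ) (F (c ∷ γ) ∘ (d ∷_)))) ⟩
    ∑< (suc a) (λ b → ∑< (suc b) (λ c → ∑≤ α (λ γ → ∑≤ (α ∸ᵥ γ) (F (c ∷ γ) ∘ ((b ∸ c) ∷_)))))
  ≡⟨ ∑<-cong (suc a) (λ b _ → ∑<-cong (suc b) (λ c _ →
       ∑≤-triangle α (λ γ δ → F (c ∷ γ) ((b ∸ c) ∷ δ)))) ⟩
    ∑< (suc a) (λ b → ∑< (suc b) (λ c → ∑≤ α (λ β → ∑≤ β (λ γ → F (c ∷ γ) ((b ∸ c) ∷ (β ∸ᵥ γ))))))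
  ≡⟨ ∑<-cong (suc a) (λ b _ → ∑<-∑≤-comm (suc b) α
       (λ c β → ∑≤ β (λ γ → F (c ∷ γ) ((b ∸ c) ∷ (β ∸ᵥ γ))))) ⟩
    ∑< (suc a) (λ b → ∑≤ α (λ β → ∑< (suc b) (λ c → ∑≤ β (λ γ → F (c ∷ γ) ((b ∸ c) ∷ (β ∸ᵥ γ)))))) ∎
  where open ≡-Reasoning

infixr 7 _·_
_·_ : ∀ {n} → ℚ → FPS n → FPS n
(c · f) α = c * f α

⊗≡∑≤ : ∀ {n} (f g : FPS n) α → (f ⊗ g) α ≡ ∑≤ α (λ β → f β * g (α ∸ᵥ β))
⊗≡∑≤ f g α = ℚsum-below α (λ β → f β * g (α ∸ᵥ β))

oneS-0ᵥ : ∀ n → oneS (0ᵥ n) ≡ 1ℚ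
oneS-0ᵥ n rewrite vecEq-refl (0ᵥ n) = refl

oneS-cases : ∀ {n} (α : Vec ℕ n) → α ≡ 0ᵥ n ⊎ oneS α ≡ 0ℚ
oneS-cases {n} α with vecEq α (0ᵥ n) in eq
... | true  = inj₁ (vecEq-sound α (0ᵥ n) (subst T (sym eq) _))
... | false = inj₂ refl

∑≤-oneS-* : ∀ {n} (α : Vec ℕ n) (φ : Vec ℕ n → ℚ) → ∑≤ α (λ β → oneS β * φ β) ≡ φ (0ᵥ n)
∑≤-oneS-* []      φ = ℚP.*-identityˡ (φ [])
∑≤-oneS-* (a ∷ α) φ =
  trans (cong₂ _+_ (∑≤-oneS-* α (φ ∘ (0 ∷_)))
                   (∑<-zero a (λ b _ → ∑≤-zero α (λ β _ → ℚP.*-zeroˡ (φ (suc b ∷ β))))))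
        (ℚP.+-identityʳ (φ (0ᵥ (suc _))))

module _ {n : ℕ} where

  ⊗-identityˡ : (f : FPS n) → oneS ⊗ f ≗ f
  ⊗-identityˡ f α =
    trans (⊗≡∑≤ oneS f α) (trans (∑≤-oneS-* α (λ β → f (α ∸ᵥ β))) (cong f (∸ᵥ-identityʳ α)))

  ⊗-comm : (f g : FPS n) → f ⊗ g ≗ g ⊗ f
  ⊗-comm f g α = begin
      (f ⊗ g) α                                        ≡⟨ ⊗≡∑≤ f g α ⟩
      ∑≤ α (λ β → f β * g (α ∸ᵥ β))                    ≡⟨ ∑≤-reverse α (λ β → f β * g (α ∸ᵥ β)) ⟩
      ∑≤ α (λ β → f (α ∸ᵥ β) * g (α ∸ᵥ (α ∸ᵥ β)))      ≡⟨ ∑≤-cong α swap ⟩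
      ∑≤ α (λ β → g β * f (α ∸ᵥ β))                    ≡⟨ ⊗≡∑≤ g f α ⟨
      (g ⊗ f) α                                        ∎
    where
    open ≡-Reasoning
    swap : ∀ β → β ≤ᵥ α → f (α ∸ᵥ β) * g (α ∸ᵥ (α ∸ᵥ β)) ≡ g β * f (α ∸ᵥ β)
    swap β β≤α = trans (cong (λ γ → f (α ∸ᵥ β) * g γ) (α∸ᵥ[α∸ᵥβ]≡β β≤α)) (ℚP.*-comm _ (g β))

  ⊗-identityʳ : (f : FPS n) → f ⊗ oneS ≗ f
  ⊗-identityʳ f α = trans (⊗-comm f oneS α) (⊗-identityˡ f α)

  ⊗-assoc : (f g h : FPS n) → (f ⊗ g) ⊗ h ≗ f ⊗ (g ⊗ h)
  ⊗-assoc f g h α = begin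
      ((f ⊗ g) ⊗ h) α
    ≡⟨ ⊗≡∑≤ (f ⊗ g) h α ⟩
      ∑≤ α (λ β → (f ⊗ g) β * h (α ∸ᵥ β))
    ≡⟨ ∑≤-cong α (λ β _ → trans (cong (_* h (α ∸ᵥ β)) (⊗≡∑≤ f g β))
                                (sym (∑≤-*ʳ β (h (α ∸ᵥ β)) (λ γ → f γ * g (β ∸ᵥ γ))))) ⟩
      ∑≤ α (λ β → ∑≤ β (λ γ → f γ * g (β ∸ᵥ γ) * h (α ∸ᵥ β)))
    ≡⟨ ∑≤-cong α (λ β β≤α → ∑≤-cong β (λ γ γ≤β →
         trans (ℚP.*-assoc (f γ) _ _)
               (cong (λ δ → f γ * (g (β ∸ᵥ γ) * h δ)) (sym ([α∸ᵥγ]∸ᵥ[β∸ᵥγ]≡α∸ᵥβ γ≤β))))) ⟩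
      ∑≤ α (λ β → ∑≤ β (λ γ → f γ * (g (β ∸ᵥ γ) * h ((α ∸ᵥ γ) ∸ᵥ (β ∸ᵥ γ)))))
    ≡⟨ ∑≤-triangle α (λ γ δ → f γ * (g δ * h ((α ∸ᵥ γ) ∸ᵥ δ))) ⟨
      ∑≤ α (λ γ → ∑≤ (α ∸ᵥ γ) (λ δ → f γ * (g δ * h ((α ∸ᵥ γ) ∸ᵥ δ))))
    ≡⟨ ∑≤-cong α (λ γ _ → trans (∑≤-*ˡ (α ∸ᵥ γ) (f γ) (λ δ → g δ * h ((α ∸ᵥ γ) ∸ᵥ δ)))
                                (cong (f γ *_) (sym (⊗≡∑≤ g h (α ∸ᵥ γ))))) ⟩
      ∑≤ α (λ γ → f γ * (g ⊗ h) (α ∸ᵥ γ))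
    ≡⟨ ⊗≡∑≤ f (g ⊗ h) α ⟨
      (f ⊗ (g ⊗ h)) α ∎
    where open ≡-Reasoning

  ⊗-congʳ-≤ᵥ : (f : FPS n) {g g′ : FPS n} (α : Vec ℕ n) → (∀ β → β ≤ᵥ α → g β ≡ g′ β) →
    (f ⊗ g) α ≡ (f ⊗ g′) α
  ⊗-congʳ-≤ᵥ f {g} {g′} α g≡g′ = trans (⊗≡∑≤ f g α) (trans
    (∑≤-cong α (λ β _ → cong (f β *_) (g≡g′ (α ∸ᵥ β) (∸ᵥ-≤ᵥ α β)))) (sym (⊗≡∑≤ f g′ α)))

  ⊗-cong : {f f′ g g′ : FPS n} → f ≗ f′ → g ≗ g′ → f ⊗ g ≗ f′ ⊗ g′
  ⊗-cong {f} {f′} {g} {g′} f≗f′ g≗g′ α = trans (⊗≡∑≤ f g α) (trans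
    (∑≤-cong α (λ β _ → cong₂ _*_ (f≗f′ β) (g≗g′ (α ∸ᵥ β)))) (sym (⊗≡∑≤ f′ g′ α)))

  ⊗-congʳ : (f : FPS n) {g g′ : FPS n} → g ≗ g′ → f ⊗ g ≗ f ⊗ g′
  ⊗-congʳ f = ⊗-cong {f} {f} (λ _ → refl)

  ⊗-distribˡ-⊕ : (f g h : FPS n) → f ⊗ (g ⊕ h) ≗ (f ⊗ g) ⊕ (f ⊗ h)
  ⊗-distribˡ-⊕ f g h α = begin
      (f ⊗ (g ⊕ h)) α
    ≡⟨ ⊗≡∑≤ f (g ⊕ h) α ⟩
      ∑≤ α (λ β → f β * (g (α ∸ᵥ β) + h (α ∸ᵥ β)))
    ≡⟨ ∑≤-cong α (λ β _ → ℚP.*-distribˡ-+ (f β) _ _) ⟩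
      ∑≤ α (λ β → f β * g (α ∸ᵥ β) + f β * h (α ∸ᵥ β))
    ≡⟨ ∑≤-+ α (λ β → f β * g (α ∸ᵥ β)) (λ β → f β * h (α ∸ᵥ β)) ⟩
      ∑≤ α (λ β → f β * g (α ∸ᵥ β)) + ∑≤ α (λ β → f β * h (α ∸ᵥ β))
    ≡⟨ cong₂ _+_ (⊗≡∑≤ f g α) (⊗≡∑≤ f h α) ⟨
      (f ⊗ g) α + (f ⊗ h) α ∎
    where open ≡-Reasoning

  ⊗-distribʳ-⊕ : (f g h : FPS n) → (f ⊕ g) ⊗ h ≗ (f ⊗ h) ⊕ (g ⊗ h)
  ⊗-distribʳ-⊕ f g h α = trans (⊗-comm (f ⊕ g) h α) (trans (⊗-distribˡ-⊕ h f g α)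
    (cong₂ _+_ (⊗-comm h f α) (⊗-comm h g α)))

  ⊗-·ʳ : (c : ℚ) (f g : FPS n) → f ⊗ (c · g) ≗ c · (f ⊗ g)
  ⊗-·ʳ c f g α = trans (⊗≡∑≤ f (c · g) α) (trans
    (∑≤-cong α (λ β _ → swap (f β) c (g (α ∸ᵥ β))))
    (trans (∑≤-*ˡ α c (λ β → f β * g (α ∸ᵥ β))) (cong (c *_) (sym (⊗≡∑≤ f g α)))))
    where
    swap : ∀ x y z → x * (y * z) ≡ y * (x * z)
    swap = solve-∀ ℚ-ring

  ⊗-zeroʳ : (f : FPS n) {g : FPS n} → (∀ β → g β ≡ 0ℚ) → ∀ α → (f ⊗ g) α ≡ 0ℚ
  ⊗-zeroʳ f {g} g≡0 α = trans (⊗≡∑≤ f g α)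
    (∑≤-zero α (λ β _ → trans (cong (f β *_) (g≡0 (α ∸ᵥ β))) (ℚP.*-zeroʳ (f β))))

does-≟-true : ∀ b → does (b BoolP.≟ true) ≡ b
does-≟-true true  = refl
does-≟-true false = refl

sumS-filter-mono : ∀ {n} (p : A → Bool) (e : A → Vec ℕ n) xs α →
  sumS (List.map (mono ∘ e) (filter (λ x → p x BoolP.≟ true) xs)) α
    ≡ ℚsum (List.map (λ x → 𝟙 (p x) * 𝟙 (vecEq α (e x))) xs)
sumS-filter-mono p e xs α = begin
    ℚsum (List.map (λ f → f α) (List.map (mono ∘ e) (filter (λ x → p x BoolP.≟ true) xs)))
  ≡⟨ cong ℚsum (ListP.map-∘ {g = λ f → f α} {f = mono ∘ e} (filter (λ x → p x BoolP.≟ true) xs)) ⟨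
    ℚsum (List.map (λ x → mono (e x) α) (filter (λ x → p x BoolP.≟ true) xs))
  ≡⟨ ℚsum-filter (λ x → p x BoolP.≟ true) (λ x → mono (e x) α) xs ⟩
    ℚsum (List.map (λ x → 𝟙 (does (p x BoolP.≟ true)) * 𝟙 (vecEq α (e x))) xs)
  ≡⟨ ℚsum-cong xs (λ x → cong (λ b → 𝟙 b * 𝟙 (vecEq α (e x))) (does-≟-true (p x))) ⟩
    ℚsum (List.map (λ x → 𝟙 (p x) * 𝟙 (vecEq α (e x))) xs) ∎
  where open ≡-Reasoning

OrderAtLeast : ∀ {n} → ℕ → FPS n → Set
OrderAtLeast p f = ∀ α → deg α < p → f α ≡ 0ℚ

m+n<o+p⇒m<o⊎n<p : ∀ m n o p → m ℕ.+ n < o ℕ.+ p → m < o ⊎ n < p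
m+n<o+p⇒m<o⊎n<p m n o p m+n<o+p with m ℕ.<? o
... | yes m<o = inj₁ m<o
... | no  m≮o = inj₂ (ℕP.+-cancelˡ-< o n p
                       (ℕP.≤-<-trans (ℕP.+-monoˡ-≤ n (ℕP.≮⇒≥ m≮o)) m+n<o+p))

module _ {n : ℕ} where

  OrderAtLeast-mono : ∀ {p q} {f : FPS n} → p ≤ q → OrderAtLeast q f → OrderAtLeast p f
  OrderAtLeast-mono p≤q ord α d = ord α (ℕP.<-≤-trans d p≤q)

  OrderAtLeast-⊗ : ∀ {p q} {f g : FPS n} → OrderAtLeast p f → OrderAtLeast q g →
    OrderAtLeast (p ℕ.+ q) (f ⊗ g)
  OrderAtLeast-⊗ {p} {q} {f} {g} ord-f ord-g α d = trans (⊗≡∑≤ f g α) (∑≤-zero α (λ β β≤α →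
    [ (λ d< → trans (cong (_* g (α ∸ᵥ β)) (ord-f β d<)) (ℚP.*-zeroˡ (g (α ∸ᵥ β))))
    , (λ d< → trans (cong (f β *_) (ord-g (α ∸ᵥ β) d<)) (ℚP.*-zeroʳ (f β)))
    ] (m+n<o+p⇒m<o⊎n<p (deg β) (deg (α ∸ᵥ β)) p q (subst (_< p ℕ.+ q) (sym (deg-∸ᵥ β≤α)) d))))

  OrderAtLeast-^S : ∀ {u : FPS n} → OrderAtLeast 1 u → ∀ i → OrderAtLeast i (u ^S i)
  OrderAtLeast-^S ord zero    α ()
  OrderAtLeast-^S ord (suc i) = OrderAtLeast-⊗ ord (OrderAtLeast-^S ord i)

  OrderAtLeast-^S-suc : ∀ {k} {u : FPS n} → OrderAtLeast k u → ∀ i → OrderAtLeast k (u ^S suc i)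
  OrderAtLeast-^S-suc {k} {u} ord i α d =
    OrderAtLeast-⊗ {q = 0} {g = u ^S i} ord (λ _ ()) α (subst (deg α <_) (sym (ℕP.+-identityʳ k)) d)

euler : ∀ {n} → FPS n → FPS n
euler f α = fromℕ (deg α) * f α

module _ {n : ℕ} where

  euler-cong : {f g : FPS n} → f ≗ g → euler f ≗ euler g
  euler-cong f≗g α = cong (fromℕ (deg α) *_) (f≗g α)

  euler-⊕ : (f g : FPS n) → euler (f ⊕ g) ≗ euler f ⊕ euler g
  euler-⊕ f g α = ℚP.*-distribˡ-+ (fromℕ (deg α)) (f α) (g α)

  euler-oneS : ∀ α → euler (oneS {n}) α ≡ 0ℚ
  euler-oneS α with oneS-cases α
  ... | inj₁ refl = trans (cong (λ d → fromℕ d * oneS (0ᵥ n)) (deg-0ᵥ n)) (ℚP.*-zeroˡ (oneS (0ᵥ n)))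
  ... | inj₂ eq   = trans (cong (fromℕ (deg α) *_) eq) (ℚP.*-zeroʳ (fromℕ (deg α)))

  euler-OrderAtLeast : ∀ {p} {f : FPS n} → OrderAtLeast p f → OrderAtLeast p (euler f)
  euler-OrderAtLeast ord α d = trans (cong (fromℕ (deg α) *_) (ord α d)) (ℚP.*-zeroʳ (fromℕ (deg α)))

  euler-⊗ : (f g : FPS n) → euler (f ⊗ g) ≗ (euler f ⊗ g) ⊕ (f ⊗ euler g)
  euler-⊗ f g α = begin
      fromℕ (deg α) * (f ⊗ g) α
    ≡⟨ cong (fromℕ (deg α) *_) (⊗≡∑≤ f g α) ⟩
      fromℕ (deg α) * ∑≤ α (λ β → f β * g (α ∸ᵥ β))
    ≡⟨ ∑≤-*ˡ α (fromℕ (deg α)) (λ β → f β * g (α ∸ᵥ β)) ⟨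
      ∑≤ α (λ β → fromℕ (deg α) * (f β * g (α ∸ᵥ β)))
    ≡⟨ ∑≤-cong α (λ β β≤α → trans
         (cong (λ d → fromℕ d * (f β * g (α ∸ᵥ β))) (sym (deg-∸ᵥ β≤α)))
         (trans (cong (_* (f β * g (α ∸ᵥ β))) (fromℕ-+ (deg β) (deg (α ∸ᵥ β))))
                (leibniz (fromℕ (deg β)) (fromℕ (deg (α ∸ᵥ β))) (f β) (g (α ∸ᵥ β))))) ⟩
      ∑≤ α (λ β → euler f β * g (α ∸ᵥ β) + f β * euler g (α ∸ᵥ β))
    ≡⟨ ∑≤-+ α (λ β → euler f β * g (α ∸ᵥ β)) (λ β → f β * euler g (α ∸ᵥ β)) ⟩
      ∑≤ α (λ β → euler f β * g (α ∸ᵥ β)) + ∑≤ α (λ β → f β * euler g (α ∸ᵥ β))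
    ≡⟨ cong₂ _+_ (⊗≡∑≤ (euler f) g α) (⊗≡∑≤ f (euler g) α) ⟨
      (euler f ⊗ g) α + (f ⊗ euler g) α ∎
    where
    open ≡-Reasoning
    leibniz : ∀ x y a b → (x + y) * (a * b) ≡ x * a * b + a * (y * b)
    leibniz = solve-∀ ℚ-ring

  euler-^S-suc : (u : FPS n) (i : ℕ) → euler (u ^S suc i) ≗ fromℕ (suc i) · ((u ^S i) ⊗ euler u)
  euler-^S-suc u zero α = begin
      euler (u ⊗ oneS) α
    ≡⟨ euler-⊗ u oneS α ⟩
      (euler u ⊗ oneS) α + (u ⊗ euler oneS) α
    ≡⟨ cong₂ _+_ (⊗-identityʳ (euler u) α) (⊗-zeroʳ u euler-oneS α) ⟩
      euler u α + 0ℚ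
    ≡⟨ ℚP.+-identityʳ (euler u α) ⟩
      euler u α
    ≡⟨ trans (ℚP.*-identityˡ _) (⊗-identityˡ (euler u) α) ⟨
      1ℚ * (oneS ⊗ euler u) α ∎
    where open ≡-Reasoning
  euler-^S-suc u (suc i) α = begin
      euler (u ⊗ (u ^S suc i)) α
    ≡⟨ euler-⊗ u (u ^S suc i) α ⟩
      (euler u ⊗ (u ^S suc i)) α + (u ⊗ euler (u ^S suc i)) α
    ≡⟨ cong₂ _+_ (⊗-comm (euler u) (u ^S suc i) α)
         (trans (⊗-congʳ u (euler-^S-suc u i) α) (⊗-·ʳ (fromℕ (suc i)) u ((u ^S i) ⊗ euler u) α)) ⟩
      ((u ^S suc i) ⊗ euler u) α + fromℕ (suc i) * (u ⊗ ((u ^S i) ⊗ euler u)) α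
    ≡⟨ cong (λ x → ((u ^S suc i) ⊗ euler u) α + fromℕ (suc i) * x) (⊗-assoc u (u ^S i) (euler u) α) ⟨
      ((u ^S suc i) ⊗ euler u) α + fromℕ (suc i) * ((u ^S suc i) ⊗ euler u) α
    ≡⟨ 1+ (((u ^S suc i) ⊗ euler u) α) (fromℕ (suc i)) ⟩
      (1ℚ + fromℕ (suc i)) * ((u ^S suc i) ⊗ euler u) α
    ≡⟨ cong (_* ((u ^S suc i) ⊗ euler u) α) (fromℕ-suc (suc i)) ⟨
      fromℕ (suc (suc i)) * ((u ^S suc i) ⊗ euler u) α ∎
    where
    open ≡-Reasoning
    1+ : ∀ x y → x + y * x ≡ (1ℚ + y) * x
    1+ = solve-∀ ℚ-ring

-- The binomial series

SolvesBinomialODE : ∀ {n} → ℚ → FPS n → FPS n → Set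
SolvesBinomialODE a w h = (oneS ⊕ w) ⊗ euler h ≗ a · (euler w ⊗ h)

binomSum : ∀ {n} → ℕ → ℚ → FPS n → FPS n
binomSum N a u β = ∑< (suc N) (λ i → binom a i * (u ^S i) β)

binomPow≡binomSum : ∀ {n} a {u : FPS n} → OrderAtLeast 1 u →
  ∀ N β → deg β ≤ N → binomPow a u β ≡ binomSum N a u β
binomPow≡binomSum a {u} ord N β deg≤N = begin
    binomPow a u β
  ≡⟨ ℚsum-applyUpTo term id (suc (deg β)) ⟩
    ∑< (suc (deg β)) term
  ≡⟨ ∑<-extend (N ∸ deg β) (suc (deg β)) term (λ i i> →
       trans (cong (binom a i *_) (OrderAtLeast-^S ord i β i>)) (ℚP.*-zeroʳ (binom a i))) ⟨
    ∑< (N ∸ deg β ℕ.+ suc (deg β)) term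
  ≡⟨ cong (λ M → ∑< M term) (trans (ℕP.+-suc (N ∸ deg β) (deg β)) (cong suc (ℕP.m∸n+n≡m deg≤N))) ⟩
    binomSum N a u β ∎
  where
  open ≡-Reasoning
  term : ℕ → ℚ
  term i = binom a i * (u ^S i) β

module _ {n : ℕ} where

  ⊗-∑< : (f : FPS n) (M : ℕ) (c : ℕ → ℚ) (G : ℕ → FPS n) →
    f ⊗ (λ β → ∑< M (λ i → c i * G i β)) ≗ λ α → ∑< M (λ i → c i * (f ⊗ G i) α)
  ⊗-∑< f M c G α = begin
      (f ⊗ (λ β → ∑< M (λ i → c i * G i β))) α
    ≡⟨ ⊗≡∑≤ f (λ β → ∑< M (λ i → c i * G i β)) α ⟩
      ∑≤ α (λ β → f β * ∑< M (λ i → c i * G i (α ∸ᵥ β)))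
    ≡⟨ ∑≤-cong α (λ β _ → trans (sym (∑<-*ˡ M (f β) (λ i → c i * G i (α ∸ᵥ β))))
                                (∑<-cong M (λ i _ → swap (f β) (c i) (G i (α ∸ᵥ β))))) ⟩
      ∑≤ α (λ β → ∑< M (λ i → c i * (f β * G i (α ∸ᵥ β))))
    ≡⟨ ∑<-∑≤-comm M α (λ i β → c i * (f β * G i (α ∸ᵥ β))) ⟨
      ∑< M (λ i → ∑≤ α (λ β → c i * (f β * G i (α ∸ᵥ β))))
    ≡⟨ ∑<-cong M (λ i _ → trans (∑≤-*ˡ α (c i) (λ β → f β * G i (α ∸ᵥ β)))
                                (cong (c i *_) (sym (⊗≡∑≤ f (G i) α)))) ⟩
      ∑< M (λ i → c i * (f ⊗ G i) α) ∎
    where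
    open ≡-Reasoning
    swap : ∀ x y z → x * (y * z) ≡ y * (x * z)
    swap = solve-∀ ℚ-ring

  euler-∑< : ∀ M (c : ℕ → ℚ) (G : ℕ → FPS n) →
    euler (λ β → ∑< M (λ i → c i * G i β)) ≗ λ β → ∑< M (λ i → c i * euler (G i) β)
  euler-∑< M c G β = trans (sym (∑<-*ˡ M (fromℕ (deg β)) (λ i → c i * G i β)))
    (∑<-cong M (λ i _ → swap (fromℕ (deg β)) (c i) (G i β)))
    where
    swap : ∀ x y z → x * (y * z) ≡ y * (x * z)
    swap = solve-∀ ℚ-ring

adjacentSum : (ℕ → ℚ) → ℕ → ℚ
adjacentSum V zero    = 0ℚ
adjacentSum V (suc i) = fromℕ (suc i) * (V i + V (suc i))

oneS⊕u-⊗-euler-^S : ∀ {n} (u : FPS n) α i →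
  ((oneS ⊕ u) ⊗ euler (u ^S i)) α ≡ adjacentSum (λ j → ((u ^S j) ⊗ euler u) α) i
oneS⊕u-⊗-euler-^S u α zero    = ⊗-zeroʳ (oneS ⊕ u) euler-oneS α
oneS⊕u-⊗-euler-^S u α (suc i) = begin
    ((oneS ⊕ u) ⊗ euler (u ^S suc i)) α
  ≡⟨ ⊗-congʳ (oneS ⊕ u) (euler-^S-suc u i) α ⟩
    ((oneS ⊕ u) ⊗ (fromℕ (suc i) · ((u ^S i) ⊗ euler u))) α
  ≡⟨ ⊗-·ʳ (fromℕ (suc i)) (oneS ⊕ u) ((u ^S i) ⊗ euler u) α ⟩
    fromℕ (suc i) * ((oneS ⊕ u) ⊗ ((u ^S i) ⊗ euler u)) α
  ≡⟨ cong (fromℕ (suc i) *_) (trans (⊗-distribʳ-⊕ oneS u ((u ^S i) ⊗ euler u) α)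
       (cong₂ _+_ (⊗-identityˡ ((u ^S i) ⊗ euler u) α) (sym (⊗-assoc u (u ^S i) (euler u) α)))) ⟩
    fromℕ (suc i) * (((u ^S i) ⊗ euler u) α + ((u ^S suc i) ⊗ euler u) α) ∎
  where open ≡-Reasoning

-- Summation by parts, using binom a (i + 1) * (i + 1) = binom a i * (a - i).
binom-telescope : ∀ a (V : ℕ → ℚ) N →
  ∑< (suc N) (λ i → binom a i * adjacentSum V i) + binom a N * (a - fromℕ N) * V N
    ≡ a * ∑< (suc N) (λ i → binom a i * V i)
binom-telescope a V zero = base a (V 0)
  where
  base : ∀ a v → 1ℚ * 0ℚ + 0ℚ + 1ℚ * (a - 0ℚ) * v ≡ a * (1ℚ * v + 0ℚ)
  base = solve-∀ ℚ-ring
binom-telescope a V (suc N) = begin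
    ∑< (suc (suc N)) (λ i → c i * adjacentSum V i) + c (suc N) * (a - fromℕ (suc N)) * V (suc N)
  ≡⟨ cong (_+ c (suc N) * (a - fromℕ (suc N)) * V (suc N)) (∑<-last (suc N) (λ i → c i * adjacentSum V i)) ⟩
    (L + c (suc N) * (fromℕ (suc N) * (V N + V (suc N)))) + c (suc N) * (a - fromℕ (suc N)) * V (suc N)
  ≡⟨ regroup L (c (suc N)) (fromℕ (suc N)) (V N) (V (suc N)) a ⟩
    (L + (c (suc N) * fromℕ (suc N)) * V N) + c (suc N) * a * V (suc N)
  ≡⟨ cong (λ x → (L + x * V N) + c (suc N) * a * V (suc N)) (binom-suc-* a N) ⟩
    (L + c N * (a - fromℕ N) * V N) + c (suc N) * a * V (suc N)
  ≡⟨ cong (_+ c (suc N) * a * V (suc N)) (binom-telescope a V N) ⟩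
    a * R + c (suc N) * a * V (suc N)
  ≡⟨ factor a R (c (suc N)) (V (suc N)) ⟩
    a * (R + c (suc N) * V (suc N))
  ≡⟨ cong (a *_) (∑<-last (suc N) (λ i → c i * V i)) ⟨
    a * ∑< (suc (suc N)) (λ i → c i * V i) ∎
  where
  open ≡-Reasoning
  c = binom a
  L = ∑< (suc N) (λ i → c i * adjacentSum V i)
  R = ∑< (suc N) (λ i → c i * V i)
  regroup : ∀ L c m v w a → (L + c * (m * (v + w))) + c * (a - m) * w ≡ (L + (c * m) * v) + c * a * w
  regroup = solve-∀ ℚ-ring
  factor : ∀ a R c w → a * R + c * a * w ≡ a * (R + c * w)
  factor = solve-∀ ℚ-ring

binomPow-solvesBinomialODE : ∀ {n} a (u : FPS n) → OrderAtLeast 1 u →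
  SolvesBinomialODE a u (binomPow a u)
binomPow-solvesBinomialODE {n} a u ord α = begin
    ((oneS ⊕ u) ⊗ euler (binomPow a u)) α
  ≡⟨ ⊗-congʳ-≤ᵥ (oneS ⊕ u) α (λ β β≤α → cong (fromℕ (deg β) *_) (truncate β β≤α)) ⟩
    ((oneS ⊕ u) ⊗ euler S) α
  ≡⟨ ⊗-congʳ (oneS ⊕ u) (euler-∑< (suc N) c U) α ⟩
    ((oneS ⊕ u) ⊗ (λ β → ∑< (suc N) (λ i → c i * euler (U i) β))) α
  ≡⟨ ⊗-∑< (oneS ⊕ u) (suc N) c (euler ∘ U) α ⟩
    ∑< (suc N) (λ i → c i * ((oneS ⊕ u) ⊗ euler (U i)) α)
  ≡⟨ ∑<-cong (suc N) (λ i _ → cong (c i *_) (oneS⊕u-⊗-euler-^S u α i)) ⟩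
    ∑< (suc N) (λ i → c i * adjacentSum V i)
  ≡⟨ ℚP.+-identityʳ _ ⟨
    ∑< (suc N) (λ i → c i * adjacentSum V i) + 0ℚ
  ≡⟨ cong (∑< (suc N) (λ i → c i * adjacentSum V i) +_)
       (trans (cong (c N * (a - fromℕ N) *_) V[N]≡0) (ℚP.*-zeroʳ (c N * (a - fromℕ N)))) ⟨
    ∑< (suc N) (λ i → c i * adjacentSum V i) + c N * (a - fromℕ N) * V N
  ≡⟨ binom-telescope a V N ⟩
    a * ∑< (suc N) (λ i → c i * V i)
  ≡⟨ cong (a *_) (∑<-cong (suc N) (λ i _ → cong (c i *_) (⊗-comm (U i) (euler u) α))) ⟩
    a * ∑< (suc N) (λ i → c i * (euler u ⊗ U i) α)
  ≡⟨ cong (a *_) (⊗-∑< (euler u) (suc N) c U α) ⟨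
    a * (euler u ⊗ S) α
  ≡⟨ cong (a *_) (⊗-congʳ-≤ᵥ (euler u) α truncate) ⟨
    a * (euler u ⊗ binomPow a u) α ∎
  where
  open ≡-Reasoning
  N = deg α
  c = binom a
  U = λ i → u ^S i
  S = binomSum N a u
  V = λ i → (U i ⊗ euler u) α
  truncate : ∀ β → β ≤ᵥ α → binomPow a u β ≡ S β
  truncate β β≤α = binomPow≡binomSum a ord N β (deg-mono-≤ᵥ β≤α)
  V[N]≡0 : V N ≡ 0ℚ
  V[N]≡0 = OrderAtLeast-⊗ {q = 1} {f = U N} (OrderAtLeast-^S ord N) (euler-OrderAtLeast ord) α
             (subst (N <_) (ℕP.+-comm 1 N) (ℕP.n<1+n N))

module _ {n : ℕ} where

  ⊗-congʳ-below : (f : FPS n) {g g′ : FPS n} → OrderAtLeast 1 f → ∀ α →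
    (∀ β → deg β < deg α → g β ≡ g′ β) → (f ⊗ g) α ≡ (f ⊗ g′) α
  ⊗-congʳ-below f {g} {g′} ord α g≡g′ =
    trans (⊗≡∑≤ f g α) (trans (∑≤-cong α term) (sym (⊗≡∑≤ f g′ α)))
    where
    term : ∀ β → β ≤ᵥ α → f β * g (α ∸ᵥ β) ≡ f β * g′ (α ∸ᵥ β)
    term β β≤α with deg β in eq
    ... | zero  = subst (λ x → x * g (α ∸ᵥ β) ≡ x * g′ (α ∸ᵥ β))
                        (sym (ord β (subst (_< 1) (sym eq) ℕP.0<1+n)))
                        (trans (ℚP.*-zeroˡ (g (α ∸ᵥ β))) (sym (ℚP.*-zeroˡ (g′ (α ∸ᵥ β)))))
    ... | suc b = cong (f β *_) (g≡g′ (α ∸ᵥ β)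
                    (subst (deg (α ∸ᵥ β) <_) (trans (cong (ℕ._+ deg (α ∸ᵥ β)) (sym eq)) (deg-∸ᵥ β≤α))
                           (s≤s (ℕP.m≤n+m (deg (α ∸ᵥ β)) b))))

  euler≡ODE-rhs : ∀ {a} {w h : FPS n} → SolvesBinomialODE a w h →
    ∀ α → euler h α ≡ a * (euler w ⊗ h) α - (w ⊗ euler h) α
  euler≡ODE-rhs {a} {w} {h} ode α = begin
      euler h α
    ≡⟨ x≡x+y-y (euler h α) ((w ⊗ euler h) α) ⟩
      (euler h α + (w ⊗ euler h) α) - (w ⊗ euler h) α
    ≡⟨ cong (_- (w ⊗ euler h) α) (trans (cong (_+ (w ⊗ euler h) α) (sym (⊗-identityˡ (euler h) α)))
                                        (sym (⊗-distribʳ-⊕ oneS w (euler h) α))) ⟩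
      ((oneS ⊕ w) ⊗ euler h) α - (w ⊗ euler h) α
    ≡⟨ cong (_- (w ⊗ euler h) α) (ode α) ⟩
      a * (euler w ⊗ h) α - (w ⊗ euler h) α ∎
    where
    open ≡-Reasoning
    x≡x+y-y : ∀ x y → x ≡ (x + y) - y
    x≡x+y-y = solve-∀ ℚ-ring

  -- Since w and E w have no constant term, the equation expresses E h α = deg α · h α
  -- through coefficients of h of lower degree.
  binomialODE-unique : ∀ a (w : FPS n) {f g : FPS n} → OrderAtLeast 1 w →
    SolvesBinomialODE a w f → SolvesBinomialODE a w g → f (0ᵥ n) ≡ g (0ᵥ n) → f ≗ g
  binomialODE-unique a w {f} {g} ord ode-f ode-g f0≡g0 α = agreeBelow (suc (deg α)) α ℕP.≤-refl
    where
    agreeAt : ∀ α → (∀ β → deg β < deg α → f β ≡ g β) → f α ≡ g α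
    agreeAt α lower with deg α in eq
    ... | zero  = trans (cong f α≡0) (trans f0≡g0 (cong g (sym α≡0)))
      where α≡0 = deg≡0⇒≡0ᵥ α eq
    ... | suc k = *-cancelˡ-fromℕ-suc k (begin
        fromℕ (suc k) * f α                        ≡⟨ cong (λ d → fromℕ d * f α) eq ⟨
        euler f α                                  ≡⟨ euler≡ODE-rhs {a} ode-f α ⟩
        a * (euler w ⊗ f) α - (w ⊗ euler f) α      ≡⟨ cong₂ (λ x y → a * x - y) lower₁ lower₂ ⟩
        a * (euler w ⊗ g) α - (w ⊗ euler g) α      ≡⟨ euler≡ODE-rhs {a} ode-g α ⟨
        euler g α                                  ≡⟨ cong (λ d → fromℕ d * g α) eq ⟩
        fromℕ (suc k) * g α                        ∎)
      where
      open ≡-Reasoning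
      lower′ : ∀ β → deg β < deg α → f β ≡ g β
      lower′ β = lower β ∘ subst (deg β <_) eq
      lower₁ : (euler w ⊗ f) α ≡ (euler w ⊗ g) α
      lower₁ = ⊗-congʳ-below (euler w) (euler-OrderAtLeast ord) α lower′
      lower₂ : (w ⊗ euler f) α ≡ (w ⊗ euler g) α
      lower₂ = ⊗-congʳ-below w ord α (λ β d → cong (fromℕ (deg β) *_) (lower′ β d))
    agreeBelow : ∀ D α → deg α < D → f α ≡ g α
    agreeBelow (suc D) α (s≤s deg≤D) =
      agreeAt α (λ β d → agreeBelow D β (ℕP.<-≤-trans d deg≤D))

-- Separated variables

infixr 7 _⊠_
_⊠_ : ∀ {n} → FPS 1 → FPS n → FPS (suc n)
(f ⊠ g) (d ∷ β) = f (d ∷ []) * g β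

module _ {n : ℕ} where

  ⊠-cong : {f f′ : FPS 1} {g g′ : FPS n} → f ≗ f′ → g ≗ g′ → f ⊠ g ≗ f′ ⊠ g′
  ⊠-cong f≗f′ g≗g′ (d ∷ β) = cong₂ _*_ (f≗f′ (d ∷ [])) (g≗g′ β)

  oneS-⊠ : oneS {suc n} ≗ oneS ⊠ oneS
  oneS-⊠ (d ∷ β) = trans (𝟙-∧ (d ℕ.≡ᵇ 0) (vecEq β (0ᵥ n)))
                         (cong (λ b → 𝟙 b * oneS β) (sym (BoolP.∧-identityʳ (d ℕ.≡ᵇ 0))))

  ⊠-⊗ : (f f′ : FPS 1) (g g′ : FPS n) → (f ⊠ g) ⊗ (f′ ⊠ g′) ≗ (f ⊗ f′) ⊠ (g ⊗ g′)
  ⊠-⊗ f f′ g g′ (d ∷ β) = begin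
      ((f ⊠ g) ⊗ (f′ ⊠ g′)) (d ∷ β)
    ≡⟨ ⊗≡∑≤ (f ⊠ g) (f′ ⊠ g′) (d ∷ β) ⟩
      ∑< (suc d) (λ b → ∑≤ β (λ γ → (f (b ∷ []) * g γ) * (f′ ((d ∸ b) ∷ []) * g′ (β ∸ᵥ γ))))
    ≡⟨ ∑<-cong (suc d) (λ b _ → trans
         (∑≤-cong β (λ γ _ → interchange (f (b ∷ [])) (g γ) (f′ ((d ∸ b) ∷ [])) (g′ (β ∸ᵥ γ))))
         (∑≤-*ˡ β (f (b ∷ []) * f′ ((d ∸ b) ∷ [])) (λ γ → g γ * g′ (β ∸ᵥ γ)))) ⟩
      ∑< (suc d) (λ b → (f (b ∷ []) * f′ ((d ∸ b) ∷ [])) * ∑≤ β (λ γ → g γ * g′ (β ∸ᵥ γ)))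
    ≡⟨ ∑<-*ʳ (suc d) (∑≤ β (λ γ → g γ * g′ (β ∸ᵥ γ))) (λ b → f (b ∷ []) * f′ ((d ∸ b) ∷ [])) ⟩
      ∑< (suc d) (λ b → f (b ∷ []) * f′ ((d ∸ b) ∷ [])) * ∑≤ β (λ γ → g γ * g′ (β ∸ᵥ γ))
    ≡⟨ cong₂ _*_ (⊗≡∑≤ f f′ (d ∷ [])) (⊗≡∑≤ g g′ β) ⟨
      ((f ⊗ f′) ⊠ (g ⊗ g′)) (d ∷ β) ∎
    where
    open ≡-Reasoning
    interchange : ∀ x y z w → (x * y) * (z * w) ≡ (x * z) * (y * w)
    interchange = solve-∀ ℚ-ring

  euler-⊠ : (f : FPS 1) (g : FPS n) → euler (f ⊠ g) ≗ (euler f ⊠ g) ⊕ (f ⊠ euler g)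
  euler-⊠ f g (d ∷ β) = begin
      fromℕ (d ℕ.+ deg β) * (f (d ∷ []) * g β)
    ≡⟨ cong (_* (f (d ∷ []) * g β)) (fromℕ-+ d (deg β)) ⟩
      (fromℕ d + fromℕ (deg β)) * (f (d ∷ []) * g β)
    ≡⟨ leibniz (fromℕ d) (fromℕ (deg β)) (f (d ∷ [])) (g β) ⟩
      fromℕ d * f (d ∷ []) * g β + f (d ∷ []) * (fromℕ (deg β) * g β)
    ≡⟨ cong (λ m → fromℕ m * f (d ∷ []) * g β + f (d ∷ []) * (fromℕ (deg β) * g β)) (ℕP.+-identityʳ d) ⟨
      (euler f ⊠ g) (d ∷ β) + (f ⊠ euler g) (d ∷ β) ∎
    where
    open ≡-Reasoning
    leibniz : ∀ x y a b → (x + y) * (a * b) ≡ x * a * b + a * (y * b)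
    leibniz = solve-∀ ℚ-ring

euler-oneS-⊕ : ∀ {n} (f : FPS n) → euler (oneS ⊕ f) ≗ euler f
euler-oneS-⊕ f α =
  trans (euler-⊕ oneS f α) (trans (cong (_+ euler f α) (euler-oneS α)) (ℚP.+-identityˡ (euler f α)))

binomialODE-⊠ : ∀ {n} a {u : FPS 1} {v : FPS n} {w : FPS (suc n)} {Bu : FPS 1} {Bv : FPS n} →
  oneS ⊕ w ≗ (oneS ⊕ u) ⊠ (oneS ⊕ v) →
  SolvesBinomialODE a u Bu → SolvesBinomialODE a v Bv → SolvesBinomialODE a w (Bu ⊠ Bv)
binomialODE-⊠ a {u} {v} {w} {Bu} {Bv} w-split ode-u ode-v (d ∷ β) = begin
    ((oneS ⊕ w) ⊗ euler (Bu ⊠ Bv)) (d ∷ β)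
  ≡⟨ ⊗-cong w-split (euler-⊠ Bu Bv) (d ∷ β) ⟩
    ((U ⊠ V) ⊗ ((euler Bu ⊠ Bv) ⊕ (Bu ⊠ euler Bv))) (d ∷ β)
  ≡⟨ ⊗-distribˡ-⊕ (U ⊠ V) (euler Bu ⊠ Bv) (Bu ⊠ euler Bv) (d ∷ β) ⟩
    ((U ⊠ V) ⊗ (euler Bu ⊠ Bv)) (d ∷ β) + ((U ⊠ V) ⊗ (Bu ⊠ euler Bv)) (d ∷ β)
  ≡⟨ cong₂ _+_ (⊠-⊗ U (euler Bu) V Bv (d ∷ β)) (⊠-⊗ U Bu V (euler Bv) (d ∷ β)) ⟩
    (U ⊗ euler Bu) (d ∷ []) * (V ⊗ Bv) β + (U ⊗ Bu) (d ∷ []) * (V ⊗ euler Bv) β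
  ≡⟨ cong₂ (λ x y → x * (V ⊗ Bv) β + (U ⊗ Bu) (d ∷ []) * y) (ode-u (d ∷ [])) (ode-v β) ⟩
    (a * (euler u ⊗ Bu) (d ∷ [])) * (V ⊗ Bv) β + (U ⊗ Bu) (d ∷ []) * (a * (euler v ⊗ Bv) β)
  ≡⟨ factor a ((euler u ⊗ Bu) (d ∷ [])) ((V ⊗ Bv) β) ((U ⊗ Bu) (d ∷ [])) ((euler v ⊗ Bv) β) ⟩
    a * ((euler u ⊗ Bu) (d ∷ []) * (V ⊗ Bv) β + (U ⊗ Bu) (d ∷ []) * (euler v ⊗ Bv) β)
  ≡⟨ cong (a *_) (cong₂ _+_ (⊠-⊗ (euler u) Bu V Bv (d ∷ β)) (⊠-⊗ U Bu (euler v) Bv (d ∷ β))) ⟨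
    a * (((euler u ⊠ V) ⊗ (Bu ⊠ Bv)) (d ∷ β) + ((U ⊠ euler v) ⊗ (Bu ⊠ Bv)) (d ∷ β))
  ≡⟨ cong (a *_) (⊗-distribʳ-⊕ (euler u ⊠ V) (U ⊠ euler v) (Bu ⊠ Bv) (d ∷ β)) ⟨
    a * (((euler u ⊠ V) ⊕ (U ⊠ euler v)) ⊗ (Bu ⊠ Bv)) (d ∷ β)
  ≡⟨ cong (a *_) (⊗-cong {g = Bu ⊠ Bv} euler-w (λ _ → refl) (d ∷ β)) ⟨
    a * (euler w ⊗ (Bu ⊠ Bv)) (d ∷ β) ∎
  where
  open ≡-Reasoning
  U = oneS ⊕ u
  V = oneS ⊕ v
  factor : ∀ a x y z w → (a * x) * y + z * (a * w) ≡ a * (x * y + z * w)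
  factor = solve-∀ ℚ-ring
  euler-w : euler w ≗ (euler u ⊠ V) ⊕ (U ⊠ euler v)
  euler-w α = begin
    euler w α                                     ≡⟨ euler-oneS-⊕ w α ⟨
    euler (oneS ⊕ w) α                            ≡⟨ euler-cong w-split α ⟩
    euler (U ⊠ V) α                               ≡⟨ euler-⊠ U V α ⟩
    (euler U ⊠ V) α + (U ⊠ euler V) α             ≡⟨ cong₂ _+_ (⊠-cong (euler-oneS-⊕ u) (λ _ → refl) α)
                                                              (⊠-cong (λ _ → refl) (euler-oneS-⊕ v) α) ⟩
    (euler u ⊠ V) α + (U ⊠ euler v) α             ∎

nonempty : ∀ {n} → Vec Bool n → Bool
nonempty = Vec.foldr _ _∨_ false

exponentOf : ∀ {n} → ℕ → Vec Bool n → Vec ℕ n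
exponentOf k = Vec.map (λ b → if b then k else 0)

ℚsum-allSubsets-suc : ∀ n (φ : Vec Bool (suc n) → ℚ) →
  ℚsum (List.map φ (allSubsets (suc n)))
    ≡ ℚsum (List.map (λ s → φ (false ∷ s) + φ (true ∷ s)) (allSubsets n))
ℚsum-allSubsets-suc n φ =
  trans (ℚsum-concatMap φ (λ s → (false ∷ s) List.∷ (true ∷ s) List.∷ List.[]) (allSubsets n))
        (ℚsum-cong (allSubsets n) (λ s → cong (φ (false ∷ s) +_) (ℚP.+-identityʳ (φ (true ∷ s)))))

-- ∏ᵢ (1 + xᵢᵏ), expanded over the subsets A of {1, …, n}
subsetPowerSum : (n k : ℕ) → FPS n
subsetPowerSum n k β = ℚsum (List.map (λ A → 𝟙 (vecEq β (exponentOf k A))) (allSubsets n))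

pbar≡ : ∀ n k β →
  pbar n k β ≡ ℚsum (List.map (λ A → 𝟙 (nonempty A) * 𝟙 (vecEq β (exponentOf k A))) (allSubsets n))
pbar≡ n k = sumS-filter-mono nonempty (exponentOf k) (allSubsets n)

emptySubsetTerm : ∀ n k β →
  ℚsum (List.map (λ A → 𝟙 (not (nonempty A)) * 𝟙 (vecEq β (exponentOf k A))) (allSubsets n)) ≡ oneS β
emptySubsetTerm zero    k []      = refl
emptySubsetTerm (suc n) k (d ∷ β) = begin
    ℚsum (List.map (λ A → 𝟙 (not (nonempty A)) * 𝟙 (vecEq (d ∷ β) (exponentOf k A))) (allSubsets (suc n)))
  ≡⟨ ℚsum-allSubsets-suc n (λ A → 𝟙 (not (nonempty A)) * 𝟙 (vecEq (d ∷ β) (exponentOf k A))) ⟩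
    ℚsum (List.map (λ s → E s * 𝟙 ((d ℕ.≡ᵇ 0) ∧ I s) + 0ℚ * 𝟙 ((d ℕ.≡ᵇ k) ∧ I s)) (allSubsets n))
  ≡⟨ ℚsum-cong (allSubsets n) (λ s → trans (cong₂ _+_ (cong (E s *_) (𝟙-∧ (d ℕ.≡ᵇ 0) (I s)))
                                                     (ℚP.*-zeroˡ (𝟙 ((d ℕ.≡ᵇ k) ∧ I s))))
                                             (pull (E s) (𝟙 (d ℕ.≡ᵇ 0)) (𝟙 (I s)))) ⟩
    ℚsum (List.map (λ s → 𝟙 (d ℕ.≡ᵇ 0) * (E s * 𝟙 (I s))) (allSubsets n))
  ≡⟨ ℚsum-*ˡ (𝟙 (d ℕ.≡ᵇ 0)) (λ s → E s * 𝟙 (I s)) (allSubsets n) ⟩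
    𝟙 (d ℕ.≡ᵇ 0) * ℚsum (List.map (λ s → E s * 𝟙 (I s)) (allSubsets n))
  ≡⟨ cong (𝟙 (d ℕ.≡ᵇ 0) *_) (emptySubsetTerm n k β) ⟩
    𝟙 (d ℕ.≡ᵇ 0) * oneS β
  ≡⟨ 𝟙-∧ (d ℕ.≡ᵇ 0) (vecEq β (0ᵥ n)) ⟨
    oneS (d ∷ β) ∎
  where
  open ≡-Reasoning
  E = λ s → 𝟙 (not (nonempty s))
  I = λ s → vecEq β (exponentOf k s)
  pull : ∀ x y z → x * (y * z) + 0ℚ ≡ y * (x * z)
  pull = solve-∀ ℚ-ring

oneS⊕pbar≡subsetPowerSum : ∀ n k → oneS ⊕ pbar n k ≗ subsetPowerSum n k
oneS⊕pbar≡subsetPowerSum n k β = begin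
    oneS β + pbar n k β
  ≡⟨ cong₂ _+_ (sym (emptySubsetTerm n k β)) (pbar≡ n k β) ⟩
    ℚsum (List.map (λ A → 𝟙 (not (nonempty A)) * I A) (allSubsets n))
      + ℚsum (List.map (λ A → 𝟙 (nonempty A) * I A) (allSubsets n))
  ≡⟨ ℚsum-+ (λ A → 𝟙 (not (nonempty A)) * I A) (λ A → 𝟙 (nonempty A) * I A) (allSubsets n) ⟨
    ℚsum (List.map (λ A → 𝟙 (not (nonempty A)) * I A + 𝟙 (nonempty A) * I A) (allSubsets n))
  ≡⟨ ℚsum-cong (allSubsets n) (λ A → complement (nonempty A) (I A)) ⟩
    subsetPowerSum n k β ∎
  where
  open ≡-Reasoning
  I = λ A → 𝟙 (vecEq β (exponentOf k A))
  complement : ∀ b x → 𝟙 (not b) * x + 𝟙 b * x ≡ x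
  complement true  x = trans (cong₂ _+_ (ℚP.*-zeroˡ x) (ℚP.*-identityˡ x)) (ℚP.+-identityˡ x)
  complement false x = trans (cong₂ _+_ (ℚP.*-identityˡ x) (ℚP.*-zeroˡ x)) (ℚP.+-identityʳ x)

subsetPowerSum-suc : ∀ n k → subsetPowerSum (suc n) k ≗ (oneS ⊕ tPow k) ⊠ subsetPowerSum n k
subsetPowerSum-suc n k (d ∷ β) = begin
    subsetPowerSum (suc n) k (d ∷ β)
  ≡⟨ ℚsum-allSubsets-suc n (λ A → 𝟙 (vecEq (d ∷ β) (exponentOf k A))) ⟩
    ℚsum (List.map (λ s → 𝟙 ((d ℕ.≡ᵇ 0) ∧ I s) + 𝟙 ((d ℕ.≡ᵇ k) ∧ I s)) (allSubsets n))
  ≡⟨ ℚsum-cong (allSubsets n) (λ s → trans (cong₂ _+_ (𝟙-∧ (d ℕ.≡ᵇ 0) (I s)) (𝟙-∧ (d ℕ.≡ᵇ k) (I s)))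
                                           (sym (ℚP.*-distribʳ-+ (𝟙 (I s)) (𝟙 (d ℕ.≡ᵇ 0)) (𝟙 (d ℕ.≡ᵇ k))))) ⟩
    ℚsum (List.map (λ s → (𝟙 (d ℕ.≡ᵇ 0) + 𝟙 (d ℕ.≡ᵇ k)) * 𝟙 (I s)) (allSubsets n))
  ≡⟨ ℚsum-*ˡ (𝟙 (d ℕ.≡ᵇ 0) + 𝟙 (d ℕ.≡ᵇ k)) (𝟙 ∘ I) (allSubsets n) ⟩
    (𝟙 (d ℕ.≡ᵇ 0) + 𝟙 (d ℕ.≡ᵇ k)) * subsetPowerSum n k β
  ≡⟨ cong (λ x → x * subsetPowerSum n k β)
       (sym (cong₂ _+_ (cong 𝟙 (BoolP.∧-identityʳ (d ℕ.≡ᵇ 0))) (cong 𝟙 (BoolP.∧-identityʳ (d ℕ.≡ᵇ k))))) ⟩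
    ((oneS ⊕ tPow k) ⊠ subsetPowerSum n k) (d ∷ β) ∎
  where
  open ≡-Reasoning
  I = λ s → vecEq β (exponentOf k s)

oneS⊕pbar-suc : ∀ n k → oneS ⊕ pbar (suc n) k ≗ (oneS ⊕ tPow k) ⊠ (oneS ⊕ pbar n k)
oneS⊕pbar-suc n k α = begin
  (oneS ⊕ pbar (suc n) k) α                    ≡⟨ oneS⊕pbar≡subsetPowerSum (suc n) k α ⟩
  subsetPowerSum (suc n) k α                   ≡⟨ subsetPowerSum-suc n k α ⟩
  ((oneS ⊕ tPow k) ⊠ subsetPowerSum n k) α     ≡⟨ ⊠-cong (λ _ → refl) (oneS⊕pbar≡subsetPowerSum n k) α ⟨
  ((oneS ⊕ tPow k) ⊠ (oneS ⊕ pbar n k)) α      ∎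
  where open ≡-Reasoning

tPow-OrderAtLeast : ∀ k → OrderAtLeast k (tPow k)
tPow-OrderAtLeast k (d ∷ []) d+0<k =
  cong (λ b → 𝟙 (b ∧ true)) (dec-false (d ℕ.≟ k) (ℕP.<⇒≢ (subst (_< k) (ℕP.+-identityʳ d) d+0<k)))

pbar-OrderAtLeast : ∀ n k → OrderAtLeast k (pbar n k)
pbar-OrderAtLeast zero    k [] _ = refl
pbar-OrderAtLeast (suc n) k (d ∷ β) deg<k = begin
    pbar (suc n) k (d ∷ β)
  ≡⟨ y≡x+y-x (oneS (d ∷ β)) (pbar (suc n) k (d ∷ β)) ⟩
    (oneS (d ∷ β) + pbar (suc n) k (d ∷ β)) - oneS (d ∷ β)
  ≡⟨ cong₂ _-_ (oneS⊕pbar-suc n k (d ∷ β)) (oneS-⊠ (d ∷ β)) ⟩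
    (oneS (d ∷ []) + tPow k (d ∷ [])) * (oneS β + pbar n k β) - oneS (d ∷ []) * oneS β
  ≡⟨ cong₂ (λ x y → (oneS (d ∷ []) + x) * (oneS β + y) - oneS (d ∷ []) * oneS β)
       (tPow-OrderAtLeast k (d ∷ []) (ℕP.≤-<-trans (ℕP.≤-reflexive (ℕP.+-identityʳ d))
                                                   (ℕP.≤-<-trans (ℕP.m≤m+n d (deg β)) deg<k)))
       (pbar-OrderAtLeast n k β (ℕP.≤-<-trans (ℕP.m≤n+m (deg β) d) deg<k)) ⟩
    (oneS (d ∷ []) + 0ℚ) * (oneS β + 0ℚ) - oneS (d ∷ []) * oneS β
  ≡⟨ cancel (oneS (d ∷ [])) (oneS β) ⟩
    0ℚ ∎
  where
  open ≡-Reasoning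
  y≡x+y-x : ∀ x y → y ≡ (x + y) - x
  y≡x+y-x = solve-∀ ℚ-ring
  cancel : ∀ x y → (x + 0ℚ) * (y + 0ℚ) - x * y ≡ 0ℚ
  cancel = solve-∀ ℚ-ring

binomPow-0ᵥ : ∀ {n} a (u : FPS n) → binomPow a u (0ᵥ n) ≡ 1ℚ
binomPow-0ᵥ {n} a u rewrite deg-0ᵥ n | oneS-0ᵥ n = refl

binomPow-pbar-suc : ∀ a n k → 1 ≤ k →
  binomPow a (pbar (suc n) k) ≗ binomPow a (tPow k) ⊠ binomPow a (pbar n k)
binomPow-pbar-suc a n k k≥1 = binomialODE-unique a (pbar (suc n) k) (ord (pbar-OrderAtLeast (suc n) k))
  (binomPow-solvesBinomialODE a (pbar (suc n) k) (ord (pbar-OrderAtLeast (suc n) k)))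
  (binomialODE-⊠ a (oneS⊕pbar-suc n k)
     (binomPow-solvesBinomialODE a (tPow k) (ord (tPow-OrderAtLeast k)))
     (binomPow-solvesBinomialODE a (pbar n k) (ord (pbar-OrderAtLeast n k))))
  (trans (binomPow-0ᵥ a (pbar (suc n) k))
         (sym (cong₂ _*_ (binomPow-0ᵥ a (tPow k)) (binomPow-0ᵥ a (pbar n k)))))
  where
  ord : ∀ {m} {u : FPS m} → OrderAtLeast k u → OrderAtLeast 1 u
  ord = OrderAtLeast-mono k≥1

-- Infinite products

UnitModuloDegree : ∀ {n} → (ℕ → FPS n) → Set
UnitModuloDegree F = ∀ k α → deg α < k → F k α ≡ oneS α

module _ {n : ℕ} {F : ℕ → FPS n} (unit : UnitModuloDegree F) where

  prodTo-stable : ∀ j M α → deg α ≤ M → prodTo F (j ℕ.+ M) α ≡ prodTo F M α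
  prodTo-stable zero    M α _     = refl
  prodTo-stable (suc j) M α deg≤M = begin
      (prodTo F (j ℕ.+ M) ⊗ F (suc (j ℕ.+ M))) α
    ≡⟨ ⊗-congʳ-≤ᵥ (prodTo F (j ℕ.+ M)) α (λ β β≤α → unit (suc (j ℕ.+ M)) β
         (s≤s (ℕP.≤-trans (deg-mono-≤ᵥ β≤α) (ℕP.≤-trans deg≤M (ℕP.m≤n+m M j))))) ⟩
      (prodTo F (j ℕ.+ M) ⊗ oneS) α
    ≡⟨ ⊗-identityʳ (prodTo F (j ℕ.+ M)) α ⟩
      prodTo F (j ℕ.+ M) α
    ≡⟨ prodTo-stable j M α deg≤M ⟩
      prodTo F M α ∎
    where open ≡-Reasoning

  prodTo≡infProd : ∀ K α → deg α ≤ K → prodTo F K α ≡ infProd F α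
  prodTo≡infProd K α deg≤K = subst (λ L → prodTo F L α ≡ infProd F α) (ℕP.m∸n+n≡m deg≤K)
    (prodTo-stable (K ∸ deg α) (deg α) α ℕP.≤-refl)

binomPow-unitModuloDegree : ∀ {n} (a : ℕ → ℚ) {u : ℕ → FPS n} → (∀ k → OrderAtLeast k (u k)) →
  UnitModuloDegree (λ k → binomPow (a k) (u k))
binomPow-unitModuloDegree a {u} ord k α deg<k = begin
    ℚsum (List.map term (upTo (suc (deg α))))
  ≡⟨ ℚsum-applyUpTo term id (suc (deg α)) ⟩
    1ℚ * oneS α + ∑< (deg α) (term ∘ suc)
  ≡⟨ cong (1ℚ * oneS α +_) (∑<-zero (deg α) (λ i _ →
       trans (cong (binom (a k) (suc i) *_) (OrderAtLeast-^S-suc (ord k) i α deg<k))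
             (ℚP.*-zeroʳ (binom (a k) (suc i))))) ⟩
    1ℚ * oneS α + 0ℚ
  ≡⟨ trans (ℚP.+-identityʳ _) (ℚP.*-identityˡ (oneS α)) ⟩
    oneS α ∎
  where
  open ≡-Reasoning
  term : ℕ → ℚ
  term i = binom (a k) i * (u k ^S i) α

module _ {n : ℕ} {F : ℕ → FPS (suc n)} {G : ℕ → FPS 1} {H : ℕ → FPS n} where

  prodTo-⊠ : (∀ k → F (suc k) ≗ G (suc k) ⊠ H (suc k)) → ∀ K → prodTo F K ≗ prodTo G K ⊠ prodTo H K
  prodTo-⊠ split zero          = oneS-⊠
  prodTo-⊠ split (suc K) α = trans (⊗-cong (prodTo-⊠ split K) (split K) α)
                                   (⊠-⊗ (prodTo G K) (G (suc K)) (prodTo H K) (H (suc K)) α)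

  infProd-⊠ : UnitModuloDegree G → UnitModuloDegree H → (∀ k → F (suc k) ≗ G (suc k) ⊠ H (suc k)) →
    ∀ d β → infProd F (d ∷ β) ≡ infProd G (d ∷ []) * infProd H β
  infProd-⊠ unit-G unit-H split d β = trans (prodTo-⊠ split (d ℕ.+ deg β) (d ∷ β))
    (cong₂ _*_ (prodTo≡infProd unit-G (d ℕ.+ deg β) (d ∷ []) (ℕP.+-monoʳ-≤ d z≤n))
               (prodTo≡infProd unit-H (d ℕ.+ deg β) β (ℕP.m≤n+m (deg β) d)))

-- The series Y

all-cong : ∀ {g h : A → Bool} xs → g ≗ h → BoolL.all g xs ≡ BoolL.all h xs
all-cong xs g≗h = cong BoolL.and (ListP.map-cong g≗h xs)

all-∧ : ∀ (g h : A → Bool) xs → BoolL.all (λ x → g x ∧ h x) xs ≡ BoolL.all g xs ∧ BoolL.all h xs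
all-∧ g h List.[]       = refl
all-∧ g h (x List.∷ xs) =
  trans (cong ((g x ∧ h x) ∧_) (all-∧ g h xs)) (∧-interchange (g x) (h x) _ _)

all-true : ∀ {g : A → Bool} xs → (∀ x → g x ≡ true) → BoolL.all g xs ≡ true
all-true List.[]       _    = refl
all-true (x List.∷ xs) g≡t = cong₂ _∧_ (g≡t x) (all-true xs g≡t)

all-allFin-suc : ∀ n (g : Fin (suc n) → Bool) →
  BoolL.all g (allFin (suc n)) ≡ g Fin.zero ∧ BoolL.all (g ∘ Fin.suc) (allFin n)
all-allFin-suc n g = cong (λ bs → g Fin.zero ∧ BoolL.and bs)
  (trans (ListP.map-tabulate Fin.suc g) (sym (ListP.map-tabulate id (g ∘ Fin.suc))))

disjoint : ∀ {k} → Vec Bool k → Vec Bool k → Bool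
disjoint {k} A B = BoolL.all (λ i → not (Vec.lookup A i ∧ Vec.lookup B i)) (allFin k)

disjoint-∷ : ∀ {k} x y (A B : Vec Bool k) → disjoint (x ∷ A) (y ∷ B) ≡ not (x ∧ y) ∧ disjoint A B
disjoint-∷ {k} x y A B = all-allFin-suc k (λ i → not (Vec.lookup (x ∷ A) i ∧ Vec.lookup (y ∷ B) i))

edgeCondition-∷ : ∀ a x y z → not a ∨ (not (x ∧ y) ∧ z) ≡ not (x ∧ y ∧ a) ∧ (not a ∨ z)
edgeCondition-∷ true  true  true  _ = refl
edgeCondition-∷ true  true  false _ = refl
edgeCondition-∷ true  false _     _ = refl
edgeCondition-∷ false true  true  _ = refl
edgeCondition-∷ false true  false _ = refl
edgeCondition-∷ false false _     _ = refl

-- Prepending a column S to κ assigns the first variable to the vertices in S.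
properMap-zipWith : ∀ {m n} (adj : Fin m → Fin m → Bool) (S : Vec Bool m) (κ : Vec (Vec Bool n) m) →
  properMap adj (zipWith _∷_ S κ) ≡ independent adj S ∧ properMap adj κ
properMap-zipWith {m} {n} adj S κ = begin
    properMap adj (zipWith _∷_ S κ)
  ≡⟨ all-cong (allFin m) (λ u → all-cong (allFin m) (λ v → column u v)) ⟩
    BoolL.all (λ u → BoolL.all (λ v → indep u v ∧ proper u v) (allFin m)) (allFin m)
  ≡⟨ all-cong (allFin m) (λ u → all-∧ (indep u) (proper u) (allFin m)) ⟩
    BoolL.all (λ u → BoolL.all (indep u) (allFin m) ∧ BoolL.all (proper u) (allFin m)) (allFin m)
  ≡⟨ all-∧ (λ u → BoolL.all (indep u) (allFin m)) (λ u → BoolL.all (proper u) (allFin m)) (allFin m) ⟩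
    independent adj S ∧ properMap adj κ ∎
  where
  open ≡-Reasoning
  S∷κ = zipWith _∷_ S κ
  indep : Fin m → Fin m → Bool
  indep u v = not (Vec.lookup S u ∧ Vec.lookup S v ∧ adj u v)
  proper : Fin m → Fin m → Bool
  proper u v = not (adj u v) ∨ disjoint (Vec.lookup κ u) (Vec.lookup κ v)
  column : ∀ u v → not (adj u v) ∨ disjoint (Vec.lookup S∷κ u) (Vec.lookup S∷κ v) ≡ indep u v ∧ proper u v
  column u v = begin
      not (adj u v) ∨ disjoint (Vec.lookup S∷κ u) (Vec.lookup S∷κ v)
    ≡⟨ cong₂ (λ A B → not (adj u v) ∨ disjoint A B)
             (VecP.lookup-zipWith _∷_ u S κ) (VecP.lookup-zipWith _∷_ v S κ) ⟩
      not (adj u v) ∨ disjoint (Vec.lookup S u ∷ κᵤ) (Vec.lookup S v ∷ κᵥ)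
    ≡⟨ cong (not (adj u v) ∨_) (disjoint-∷ (Vec.lookup S u) (Vec.lookup S v) κᵤ κᵥ) ⟩
      not (adj u v) ∨ (not (Vec.lookup S u ∧ Vec.lookup S v) ∧ disjoint κᵤ κᵥ)
    ≡⟨ edgeCondition-∷ (adj u v) (Vec.lookup S u) (Vec.lookup S v) (disjoint κᵤ κᵥ) ⟩
      indep u v ∧ proper u v ∎
    where
    κᵤ = Vec.lookup κ u
    κᵥ = Vec.lookup κ v

kappaExp-zipWith : ∀ {m n} (ω : Fin m → ℕ) (S : Vec Bool m) (κ : Vec (Vec Bool n) m) →
  kappaExp ω (zipWith _∷_ S κ) ≡ weightOf ω S ∷ kappaExp ω κ
kappaExp-zipWith {m} {n} ω S κ = cong₂ _∷_ (column Fin.zero) (VecP.tabulate-cong (column ∘ Fin.suc))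
  where
  weightAt : Vec Bool (suc n) → Fin m → Fin (suc n) → ℕ
  weightAt A v i = if Vec.lookup A i then ω v else 0
  column : ∀ i → ℕL.sum (List.map (λ v → weightAt (Vec.lookup (zipWith _∷_ S κ) v) v i) (allFin m))
               ≡ ℕL.sum (List.map (λ v → weightAt (Vec.lookup S v ∷ Vec.lookup κ v) v i) (allFin m))
  column i = cong ℕL.sum (ListP.map-cong
    (λ v → cong (λ A → weightAt A v i) (VecP.lookup-zipWith _∷_ v S κ)) (allFin m))

ℚsum-allVecs-suc : ∀ (xs : List A) m (Φ : Vec A (suc m) → ℚ) →
  ℚsum (List.map Φ (allVecs xs (suc m)))
    ≡ ℚsum (List.map (λ x → ℚsum (List.map (Φ ∘ (x ∷_)) (allVecs xs m))) xs)
ℚsum-allVecs-suc xs m Φ = trans (ℚsum-concatMap Φ (λ x → List.map (x ∷_) (allVecs xs m)) xs)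
  (ℚsum-cong xs (λ x → cong ℚsum (sym (ListP.map-∘ {g = Φ} {f = x ∷_} (allVecs xs m)))))

ℚsum-allVecs-allSubsets-suc : ∀ n m (Φ : Vec (Vec Bool (suc n)) m → ℚ) →
  ℚsum (List.map Φ (allVecs (allSubsets (suc n)) m))
    ≡ ℚsum (List.map (λ S → ℚsum (List.map (Φ ∘ zipWith _∷_ S) (allVecs (allSubsets n) m))) (allSubsets m))
ℚsum-allVecs-allSubsets-suc n zero    Φ = sym (ℚP.+-identityʳ _)
ℚsum-allVecs-allSubsets-suc n (suc m) Φ = begin
    ℚsum (List.map Φ (allVecs (allSubsets (suc n)) (suc m)))
  ≡⟨ ℚsum-allVecs-suc (allSubsets (suc n)) m Φ ⟩
    ℚsum (List.map (λ x → ℚsum (List.map (Φ ∘ (x ∷_)) (allVecs (allSubsets (suc n)) m))) (allSubsets (suc n)))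
  ≡⟨ ℚsum-cong (allSubsets (suc n)) (λ x → ℚsum-allVecs-allSubsets-suc n m (Φ ∘ (x ∷_))) ⟩
    ℚsum (List.map (λ x → ℚsum (List.map (λ S → H S x) (allSubsets m))) (allSubsets (suc n)))
  ≡⟨ ℚsum-comm (λ x S → H S x) (allSubsets (suc n)) (allSubsets m) ⟩
    ℚsum (List.map (λ S → ℚsum (List.map (H S) (allSubsets (suc n)))) (allSubsets m))
  ≡⟨ ℚsum-cong (allSubsets m) (λ S → trans (ℚsum-allSubsets-suc n (H S))
       (ℚsum-+ (λ s → H S (false ∷ s)) (λ s → H S (true ∷ s)) (allSubsets n))) ⟩
    ℚsum (List.map (λ S → ℚsum (List.map (λ s → H S (false ∷ s)) (allSubsets n))
                        + ℚsum (List.map (λ s → H S (true ∷ s)) (allSubsets n))) (allSubsets m))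
  ≡⟨ ℚsum-cong (allSubsets m) (λ S → cong₂ _+_ (K≡ false S) (K≡ true S)) ⟨
    ℚsum (List.map (λ S → K (false ∷ S) + K (true ∷ S)) (allSubsets m))
  ≡⟨ ℚsum-allSubsets-suc m K ⟨
    ℚsum (List.map K (allSubsets (suc m))) ∎
  where
  open ≡-Reasoning
  H : Vec Bool m → Vec Bool (suc n) → ℚ
  H S x = ℚsum (List.map (λ κ → Φ (x ∷ zipWith _∷_ S κ)) (allVecs (allSubsets n) m))
  K : Vec Bool (suc m) → ℚ
  K S = ℚsum (List.map (Φ ∘ zipWith _∷_ S) (allVecs (allSubsets n) (suc m)))
  K≡ : ∀ b S → K (b ∷ S) ≡ ℚsum (List.map (λ s → H S (b ∷ s)) (allSubsets n))
  K≡ b S = ℚsum-allVecs-suc (allSubsets n) m (Φ ∘ zipWith _∷_ (b ∷ S))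

allVecs-singleton : ∀ (x : A) k → allVecs (x List.∷ List.[]) k ≡ Vec.replicate k x List.∷ List.[]
allVecs-singleton x zero    = refl
allVecs-singleton x (suc k) rewrite allVecs-singleton x k = refl

module _ {m : ℕ} (adj : Fin m → Fin m → Bool) (ω : Fin m → ℕ) where

  colouringTerm : ∀ {n} → Vec ℕ n → Vec (Vec Bool n) m → ℚ
  colouringTerm α κ = 𝟙 (properMap adj κ) * 𝟙 (vecEq α (kappaExp ω κ))

  independentTerm : ℕ → Vec Bool m → ℚ
  independentTerm d S = 𝟙 (independent adj S) * 𝟙 (d ℕ.≡ᵇ weightOf ω S)

  Yser≡ : ∀ n α → Yser adj ω n α ≡ ℚsum (List.map (colouringTerm α) (allVecs (allSubsets n) m))
  Yser≡ n = sumS-filter-mono (properMap adj) (kappaExp ω) (allVecs (allSubsets n) m)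

  indepPoly≡ : ∀ d → indepPoly adj ω (d ∷ []) ≡ ℚsum (List.map (independentTerm d) (allSubsets m))
  indepPoly≡ d = trans
    (sumS-filter-mono (independent adj) (λ S → weightOf ω S ∷ []) (allSubsets m) (d ∷ []))
    (ℚsum-cong (allSubsets m) (λ S → cong (λ b → 𝟙 (independent adj S) * 𝟙 b)
                                           (BoolP.∧-identityʳ (d ℕ.≡ᵇ weightOf ω S))))

  colouringTerm-zipWith : ∀ {n} d β S (κ : Vec (Vec Bool n) m) →
    colouringTerm (d ∷ β) (zipWith _∷_ S κ) ≡ independentTerm d S * colouringTerm β κ
  colouringTerm-zipWith d β S κ = begin
      𝟙 (properMap adj (zipWith _∷_ S κ)) * 𝟙 (vecEq (d ∷ β) (kappaExp ω (zipWith _∷_ S κ)))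
    ≡⟨ cong₂ (λ p e → 𝟙 p * 𝟙 (vecEq (d ∷ β) e)) (properMap-zipWith adj S κ) (kappaExp-zipWith ω S κ) ⟩
      𝟙 (independent adj S ∧ properMap adj κ) * 𝟙 ((d ℕ.≡ᵇ weightOf ω S) ∧ vecEq β (kappaExp ω κ))
    ≡⟨ cong₂ _*_ (𝟙-∧ (independent adj S) (properMap adj κ))
                 (𝟙-∧ (d ℕ.≡ᵇ weightOf ω S) (vecEq β (kappaExp ω κ))) ⟩
      (𝟙 (independent adj S) * 𝟙 (properMap adj κ)) * (𝟙 (d ℕ.≡ᵇ weightOf ω S) * 𝟙 (vecEq β (kappaExp ω κ)))
    ≡⟨ interchange (𝟙 (independent adj S)) (𝟙 (properMap adj κ))
                   (𝟙 (d ℕ.≡ᵇ weightOf ω S)) (𝟙 (vecEq β (kappaExp ω κ))) ⟩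
      independentTerm d S * colouringTerm β κ ∎
    where
    open ≡-Reasoning
    interchange : ∀ a b c e → (a * b) * (c * e) ≡ (a * c) * (b * e)
    interchange = solve-∀ ℚ-ring

  properMap-zeroVariables : (κ : Vec (Vec Bool 0) m) → properMap adj κ ≡ true
  properMap-zeroVariables κ =
    all-true (allFin m) (λ u → all-true (allFin m) (λ v → BoolP.∨-zeroʳ (not (adj u v))))

  Yser-zero : Yser adj ω 0 [] ≡ 1ℚ
  Yser-zero = begin
      Yser adj ω 0 []
    ≡⟨ Yser≡ 0 [] ⟩
      ℚsum (List.map (colouringTerm []) (allVecs (allSubsets 0) m))
    ≡⟨ cong (ℚsum ∘ List.map (colouringTerm [])) (allVecs-singleton [] m) ⟩
      𝟙 (properMap adj (Vec.replicate m [])) * 1ℚ + 0ℚ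
    ≡⟨ cong (λ b → 𝟙 b * 1ℚ + 0ℚ) (properMap-zeroVariables (Vec.replicate m [])) ⟩
      1ℚ ∎
    where open ≡-Reasoning

  Yser-suc : ∀ n d β → Yser adj ω (suc n) (d ∷ β) ≡ indepPoly adj ω (d ∷ []) * Yser adj ω n β
  Yser-suc n d β = begin
      Yser adj ω (suc n) (d ∷ β)
    ≡⟨ Yser≡ (suc n) (d ∷ β) ⟩
      ℚsum (List.map (colouringTerm (d ∷ β)) (allVecs (allSubsets (suc n)) m))
    ≡⟨ ℚsum-allVecs-allSubsets-suc n m (colouringTerm (d ∷ β)) ⟩
      ℚsum (List.map (λ S → ℚsum (List.map (colouringTerm (d ∷ β) ∘ zipWith _∷_ S) κs)) (allSubsets m))
    ≡⟨ ℚsum-cong (allSubsets m) (λ S → trans (ℚsum-cong κs (colouringTerm-zipWith d β S))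
                                             (ℚsum-*ˡ (independentTerm d S) (colouringTerm β) κs)) ⟩
      ℚsum (List.map (λ S → independentTerm d S * ℚsum (List.map (colouringTerm β) κs)) (allSubsets m))
    ≡⟨ ℚsum-*ʳ (ℚsum (List.map (colouringTerm β) κs)) (independentTerm d) (allSubsets m) ⟩
      ℚsum (List.map (independentTerm d) (allSubsets m)) * ℚsum (List.map (colouringTerm β) κs)
    ≡⟨ cong₂ _*_ (indepPoly≡ d) (Yser≡ n β) ⟨
      indepPoly adj ω (d ∷ []) * Yser adj ω n β ∎
    where
    open ≡-Reasoning
    κs = allVecs (allSubsets n) m

lemma4p1 : (m : ℕ) (adj : Fin m → Fin m → Bool) (ω : Fin m → ℕ)
    → (∀ u v → adj u v ≡ adj v u)
    → (∀ v → adj v v ≡ false)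
    → (∀ v → 1 ≤ ω v)
    → (a : ℕ → ℚ)
    → (∀ (α : Vec ℕ 1) → infProd (λ k → binomPow (a k) (tPow k)) α ≡ indepPoly adj ω α)
    → ∀ (n : ℕ) (α : Vec ℕ n) → Yser adj ω n α ≡ infProd (λ k → binomPow (a k) (pbar n k)) α
lemma4p1 m adj ω _ _ _ a I≡∏ = Y≡∏
  where
  Y≡∏ : ∀ n (α : Vec ℕ n) → Yser adj ω n α ≡ infProd (λ k → binomPow (a k) (pbar n k)) α
  Y≡∏ zero    []      = Yser-zero adj ω
  Y≡∏ (suc n) (d ∷ β) = begin
      Yser adj ω (suc n) (d ∷ β)
    ≡⟨ Yser-suc adj ω n d β ⟩
      indepPoly adj ω (d ∷ []) * Yser adj ω n β
    ≡⟨ cong₂ _*_ (sym (I≡∏ (d ∷ []))) (Y≡∏ n β) ⟩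
      infProd (λ k → binomPow (a k) (tPow k)) (d ∷ []) * infProd (λ k → binomPow (a k) (pbar n k)) β
    ≡⟨ infProd-⊠ (binomPow-unitModuloDegree a tPow-OrderAtLeast)
                 (binomPow-unitModuloDegree a (pbar-OrderAtLeast n))
                 (λ k → binomPow-pbar-suc (a (suc k)) n (suc k) (s≤s z≤n)) d β ⟨
      infProd (λ k → binomPow (a k) (pbar (suc n) k)) (d ∷ β) ∎
    where open ≡-Reasoning
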